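{- Let $n\geq2$, let $G$ be a finite abelian group and let $(a_1,\dots,a_n)$ be an $n$-tuple of elements of $G^\vee$ with $\sum_j\mathbb{Z}a_j=G^\vee$. Then $$\sum_{\varepsilon_1,\varepsilon_2\in\{\pm1\}}\langle\varepsilon_1a_1,\varepsilon_2a_2,a_3,\dots,a_n\rangle=0\quad\text{in }\mathcal{M}_n(G)\otimes\mathbb{Q}.$$
   Context: $G^\vee=\mathrm{Hom}(G,\mathbb{C}^\times)$, written additively. For $n\ge 2$, $\mathcal{M}_n(G)$ is the quotient of the free $\mathbb{Z}$-module on $n$-tuples $(c_1,\dots,c_n)$ of elements of $G^\vee$ with $\sum_j\mathbb{Z}c_j=G^\vee$ by the relations (O) $(c_1,\dots,c_n)=(c_{\sigma(1)},\dots,c_{\sigma(n)})$ for all permutations $\sigma$, and (M) $(c_1,c_2,c_3,\dots,c_n)=(c_1-c_2,c_2,c_3,\dots,c_n)+(c_1,c_2-c_1,c_3,\dots,c_n)$. The class of $(c_1,\dots,c_n)$ is denoted $\langle c_1,\dots,c_n\rangle$. -}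

module Defs where

open import Level using (Level; _⊔_)
open import Data.Nat using (ℕ; zero; suc)
open import Data.Fin using (Fin)
import Data.Fin as F
open import Data.Fin.Permutation using (Permutation; _⟨$⟩ʳ_)
open import Data.Vec.Functional using (_∷_)
open import Data.Product using (∃)
open import Algebra.Bundles using (AbelianGroup)
open import Function.Bundles using (Surjection)
import Relation.Binary.PropositionalEquality as P
import Algebra.Properties.Group as GP

private variable c ℓ : Level

Finite : AbelianGroup c ℓ → Set (c ⊔ ℓ)
Finite A = ∃ λ k → Surjection (P.setoid (Fin k)) (AbelianGroup.setoid A)

module _ (A : AbelianGroup c ℓ) where
  open AbelianGroup A

  data InSpan {n : ℕ} (t : Fin n → Carrier) : Carrier → Set (c ⊔ ℓ) where
    span-gen  : ∀ j → InSpan t (t j)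
    span-ε    : InSpan t ε
    span-inv  : ∀ {x} → InSpan t x → InSpan t (x ⁻¹)
    span-∙    : ∀ {x y} → InSpan t x → InSpan t y → InSpan t (x ∙ y)
    span-resp : ∀ {x y} → x ≈ y → InSpan t x → InSpan t y

  Spans : {n : ℕ} → (Fin n → Carrier) → Set (c ⊔ ℓ)
  Spans t = ∀ a → InSpan t a

  -- Formal ℤ-linear combinations of spanning n-tuples (terms of the free
  -- abelian group on spanning n-tuples), n = 2 + m.
  data Expr (m : ℕ) : Set (c ⊔ ℓ) where
    gen  : (t : Fin (suc (suc m)) → Carrier) → Spans t → Expr m
    zer  : Expr m
    _⊕_  : Expr m → Expr m → Expr m
    neg  : Expr m → Expr m

  infixl 6 _⊕_
  infix 4 _∼_

  -- Equality in M_n(G): the congruence generated by the abelian group laws,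
  -- (generators are tuples, compared pointwise up to ≈), relation (O) and (M).
  data _∼_ {m : ℕ} : Expr m → Expr m → Set (c ⊔ ℓ) where
    ∼-refl  : ∀ {x} → x ∼ x
    ∼-sym   : ∀ {x y} → x ∼ y → y ∼ x
    ∼-trans : ∀ {x y z} → x ∼ y → y ∼ z → x ∼ z
    ⊕-cong  : ∀ {x x' y y'} → x ∼ x' → y ∼ y' → x ⊕ y ∼ x' ⊕ y'
    neg-cong : ∀ {x y} → x ∼ y → neg x ∼ neg y
    ⊕-assoc : ∀ x y z → (x ⊕ y) ⊕ z ∼ x ⊕ (y ⊕ z)
    ⊕-comm  : ∀ x y → x ⊕ y ∼ y ⊕ x
    ⊕-idʳ   : ∀ x → x ⊕ zer ∼ x
    ⊕-invʳ  : ∀ x → x ⊕ neg x ∼ zer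
    gen-cong : ∀ {t t'} (p : Spans t) (q : Spans t') →
               (∀ j → t j ≈ t' j) → gen t p ∼ gen t' q
    rel-O   : ∀ t (σ : Permutation (suc (suc m)) (suc (suc m)))
              (p : Spans t) (q : Spans (λ j → t (σ ⟨$⟩ʳ j))) →
              gen t p ∼ gen (λ j → t (σ ⟨$⟩ʳ j)) q
    rel-M   : ∀ x y (r : Fin m → Carrier)
              (p : Spans (x ∷ y ∷ r))
              (q₁ : Spans ((x ∙ y ⁻¹) ∷ y ∷ r))
              (q₂ : Spans (x ∷ (y ∙ x ⁻¹) ∷ r)) →
              gen (x ∷ y ∷ r) p ∼ gen ((x ∙ y ⁻¹) ∷ y ∷ r) q₁ ⊕ gen (x ∷ (y ∙ x ⁻¹) ∷ r) q₂

  _·_ : {m : ℕ} → ℕ → Expr m → Expr m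
  zero  · e = zer
  suc N · e = e ⊕ (N · e)

  -- An element of M_n(G) maps to 0 in M_n(G) ⊗ ℚ iff it is torsion.
  IsZeroTensorℚ : {m : ℕ} → Expr m → Set (c ⊔ ℓ)
  IsZeroTensorℚ e = ∃ λ N → suc N · e ∼ zer

  private
    module G = GP group

    spans-neg₁ : ∀ {m} x y (r : Fin m → Carrier) →
                 Spans (x ∷ y ∷ r) → Spans ((x ⁻¹) ∷ y ∷ r)
    spans-neg₁ {m} x y r s a = go (s a)
      where
      go : ∀ {b} → InSpan (x ∷ y ∷ r) b → InSpan ((x ⁻¹) ∷ y ∷ r) b
      go (span-gen F.zero) = span-resp (G.⁻¹-involutive x) (span-inv (span-gen F.zero))
      go (span-gen (F.suc j)) = span-gen (F.suc j)
      go span-ε = span-ε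
      go (span-inv h) = span-inv (go h)
      go (span-∙ h k) = span-∙ (go h) (go k)
      go (span-resp e h) = span-resp e (go h)

    spans-neg₂ : ∀ {m} x y (r : Fin m → Carrier) →
                 Spans (x ∷ y ∷ r) → Spans (x ∷ (y ⁻¹) ∷ r)
    spans-neg₂ {m} x y r s a = go (s a)
      where
      go : ∀ {b} → InSpan (x ∷ y ∷ r) b → InSpan (x ∷ (y ⁻¹) ∷ r) b
      go (span-gen (F.suc F.zero)) = span-resp (G.⁻¹-involutive y) (span-inv (span-gen (F.suc F.zero)))
      go (span-gen F.zero) = span-gen F.zero
      go (span-gen (F.suc (F.suc j))) = span-gen (F.suc (F.suc j))
      go span-ε = span-ε
      go (span-inv h) = span-inv (go h)
      go (span-∙ h k) = span-∙ (go h) (go k)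
      go (span-resp e h) = span-resp e (go h)

  signSum : ∀ {m} x y (r : Fin m → Carrier) → Spans (x ∷ y ∷ r) → Expr m
  signSum x y r s =
      gen (x ∷ y ∷ r) s
    ⊕ gen ((x ⁻¹) ∷ y ∷ r) (spans-neg₁ x y r s)
    ⊕ gen (x ∷ (y ⁻¹) ∷ r) (spans-neg₂ x y r s)
    ⊕ gen ((x ⁻¹) ∷ (y ⁻¹) ∷ r) (spans-neg₂ (x ⁻¹) y r (spans-neg₁ x y r s))

{-# OPTIONS --safe #-}
module Submission where

-- Write S(x , y) for the sum of the four symbols ⟨± x , ± y , a₃ , …⟩. Relation (O) makes
-- S invariant under (x , y) ↦ (y , x) and (x⁻¹ , y), and two instances of (M) make it
-- invariant under (x , y) ↦ (x - y , y). If N kills a₁ and a₂, the Euclidean algorithm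
-- therefore gives S(u , v) = S(a₁ , a₂) for every pair (u , v) = (a₁ , a₂) · g with
-- g ∈ SL₂(ℤ/N). On the other hand S(u , v) is the sum of ⟨·,·⟩ over the orbit of (u , v)
-- under the rotation (u , v) ↦ (v , u⁻¹) of order 4, and, by three more instances of (M),
-- also over the orbit of (u , v) ↦ (v - u , u⁻¹) of order 3. Summing over all g, the
-- first description gives 4X and the second 3X, where X = ∑_g ⟨(a₁ , a₂) · g⟩. Hence
-- X = 0, and #SL₂(ℤ/N) · S(a₁ , a₂) = 0.

open import Defs
open import Level using (Level; _⊔_; 0ℓ)
open import Relation.Binary.Bundles using (Setoid)
open import Data.Nat as ℕ using (ℕ; zero; suc)
open import Data.Integer as ℤ using (ℤ; +_; -[1+_]; _⊖_)
import Data.Integer.Properties as ℤ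
import Data.Nat.Properties as ℕ
open import Data.Integer.DivMod using (_%ℕ_; _/ℕ_; a≡a%ℕn+[a/ℕn]*n)
open import Data.Integer.Divisibility.Signed
  using (_∣_; _∣?_; divides; ∣-refl; ∣m∣n⇒∣m+n; ∣m⇒∣-m; ∣m⇒∣m*n; ∣n⇒∣m*n)
open import Data.Integer.Tactic.RingSolver using (solve-∀)
open import Algebra.Bundles using (AbelianGroup; CommutativeMonoid)
open import Data.Fin as Fin using (Fin; toℕ)
import Data.Fin.Properties as Fin
open import Data.Fin.Permutation using (lift₀; reverse; transpose; _⟨$⟩ʳ_)
open import Data.Vec.Functional using (_∷_)
open import Relation.Binary.PropositionalEquality as ≡ using (_≡_)
open import Data.Product as Σ using (_,_; ∃; ∃₂)
open import Function using (_∘_; _$_)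
open import Relation.Nullary using (Dec; yes; no; ¬_)
import Relation.Nullary.Decidable as Dec

private variable c ℓ : Level

infixl 6 _+ᵛ_ _-ᵛ_
infixr 7 _·ᵛ_
infix  8 -ᵛ_

ℤ² : Set
ℤ² = ℤ Σ.× ℤ

_+ᵛ_ : ℤ² → ℤ² → ℤ²
(α , γ) +ᵛ (β , δ) = (α ℤ.+ β , γ ℤ.+ δ)

-ᵛ_ : ℤ² → ℤ²
-ᵛ (α , γ) = (ℤ.- α , ℤ.- γ)

_-ᵛ_ : ℤ² → ℤ² → ℤ²
p -ᵛ q = p +ᵛ -ᵛ q

_·ᵛ_ : ℤ → ℤ² → ℤ²
k ·ᵛ (α , γ) = (k ℤ.* α , k ℤ.* γ)

Mat₂ : Set
Mat₂ = ℤ² Σ.× ℤ²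

det : Mat₂ → ℤ
det ((α , γ) , (β , δ)) = α ℤ.* δ ℤ.- γ ℤ.* β

rot : Mat₂ → Mat₂
rot (p , q) = (q , -ᵛ p)

tri : Mat₂ → Mat₂
tri (p , q) = (q -ᵛ p , -ᵛ p)

shear₁ : ℤ → Mat₂ → Mat₂
shear₁ k (p , q) = (p +ᵛ k ·ᵛ q , q)

shear₂ : ℤ → Mat₂ → Mat₂
shear₂ k (p , q) = (p , q +ᵛ k ·ᵛ p)

det-rot : ∀ g → det (rot g) ≡ det g
det-rot ((α , γ) , (β , δ)) = ring α β γ δ
  where
  ring : ∀ α β γ δ → β ℤ.* ℤ.- γ ℤ.- δ ℤ.* ℤ.- α ≡ α ℤ.* δ ℤ.- γ ℤ.* β
  ring = solve-∀

det-tri : ∀ g → det (tri g) ≡ det g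
det-tri ((α , γ) , (β , δ)) = ring α β γ δ
  where
  ring : ∀ α β γ δ → (β ℤ.- α) ℤ.* ℤ.- γ ℤ.- (δ ℤ.- γ) ℤ.* ℤ.- α ≡ α ℤ.* δ ℤ.- γ ℤ.* β
  ring = solve-∀

det-shear₁ : ∀ k g → det (shear₁ k g) ≡ det g
det-shear₁ k ((α , γ) , (β , δ)) = ring k α β γ δ
  where
  ring : ∀ k α β γ δ → (α ℤ.+ k ℤ.* β) ℤ.* δ ℤ.- (γ ℤ.+ k ℤ.* δ) ℤ.* β ≡ α ℤ.* δ ℤ.- γ ℤ.* β
  ring = solve-∀

det-shear₂ : ∀ k g → det (shear₂ k g) ≡ det g
det-shear₂ k ((α , γ) , (β , δ)) = ring k α β γ δ
  where
  ring : ∀ k α β γ δ → α ℤ.* (δ ℤ.+ k ℤ.* γ) ℤ.- γ ℤ.* (β ℤ.+ k ℤ.* α) ≡ α ℤ.* δ ℤ.- γ ℤ.* β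
  ring = solve-∀

module Congruence (n : ℕ) where

  infix 4 _≋_
  record _≋_ (x y : ℤ) : Set where
    constructor mod-∣
    field ∣-difference : + n ∣ x ℤ.- y
  open _≋_ public

  private
    ≋-by : ∀ x y {d} → + n ∣ d → d ≡ x ℤ.- y → x ≋ y
    ≋-by x y n∣d ≡.refl = mod-∣ n∣d

  ≋-reflexive : ∀ {x y} → x ≡ y → x ≋ y
  ≋-reflexive {x} ≡.refl = mod-∣ (divides (+ 0) (ℤ.+-inverseʳ x))

  ≋-refl : ∀ {x} → x ≋ x
  ≋-refl = ≋-reflexive ≡.refl

  ≋-sym : ∀ {x y} → x ≋ y → y ≋ x
  ≋-sym {x} {y} x≋y = ≋-by y x (∣m⇒∣-m (∣-difference x≋y)) (ring x y)
    where
    ring : ∀ x y → ℤ.- (x ℤ.- y) ≡ y ℤ.- x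
    ring = solve-∀

  ≋-trans : ∀ {x y z} → x ≋ y → y ≋ z → x ≋ z
  ≋-trans {x} {y} {z} x≋y y≋z = ≋-by x z (∣m∣n⇒∣m+n (∣-difference x≋y) (∣-difference y≋z)) (ring x y z)
    where
    ring : ∀ x y z → (x ℤ.- y) ℤ.+ (y ℤ.- z) ≡ x ℤ.- z
    ring = solve-∀

  ≋-residue : .{{_ : ℕ.NonZero n}} → ∀ z → z ≋ + (z %ℕ n)
  ≋-residue z = ≋-trans (≋-reflexive (a≡a%ℕn+[a/ℕn]*n z n))
                        (mod-∣ (divides (z /ℕ n) (ring (+ (z %ℕ n)) (z /ℕ n) (+ n))))
    where
    ring : ∀ r q n → r ℤ.+ q ℤ.* n ℤ.- r ≡ q ℤ.* n
    ring = solve-∀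

  ≋-setoid : Setoid 0ℓ 0ℓ
  ≋-setoid = record { Carrier = ℤ ; _≈_ = _≋_
                    ; isEquivalence = record { refl = ≋-refl ; sym = ≋-sym ; trans = ≋-trans } }

  modulus≋0 : + n ≋ + 0
  modulus≋0 = mod-∣ (divides (+ 1) (ring (+ n)))
    where
    ring : ∀ n → n ℤ.- + 0 ≡ + 1 ℤ.* n
    ring = solve-∀

  +-cong-≋ : ∀ {x x' y y'} → x ≋ x' → y ≋ y' → x ℤ.+ y ≋ x' ℤ.+ y'
  +-cong-≋ {x} {x'} {y} {y'} x≋x' y≋y' =
    ≋-by (x ℤ.+ y) (x' ℤ.+ y') (∣m∣n⇒∣m+n (∣-difference x≋x') (∣-difference y≋y')) (ring x x' y y')
    where
    ring : ∀ x x' y y' → (x ℤ.- x') ℤ.+ (y ℤ.- y') ≡ (x ℤ.+ y) ℤ.- (x' ℤ.+ y')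
    ring = solve-∀

  neg-cong-≋ : ∀ {x x'} → x ≋ x' → ℤ.- x ≋ ℤ.- x'
  neg-cong-≋ {x} {x'} x≋x' = ≋-by (ℤ.- x) (ℤ.- x') (∣m⇒∣-m (∣-difference x≋x')) (ring x x')
    where
    ring : ∀ x x' → ℤ.- (x ℤ.- x') ≡ ℤ.- x ℤ.- ℤ.- x'
    ring = solve-∀

  *-cong-≋ : ∀ {x x' y y'} → x ≋ x' → y ≋ y' → x ℤ.* y ≋ x' ℤ.* y'
  *-cong-≋ {x} {x'} {y} {y'} x≋x' y≋y' =
    ≋-by (x ℤ.* y) (x' ℤ.* y')
         (∣m∣n⇒∣m+n (∣m⇒∣m*n y (∣-difference x≋x')) (∣n⇒∣m*n x' (∣-difference y≋y'))) (ring x x' y y')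
    where
    ring : ∀ x x' y y' → (x ℤ.- x') ℤ.* y ℤ.+ x' ℤ.* (y ℤ.- y') ≡ x ℤ.* y ℤ.- x' ℤ.* y'
    ring = solve-∀

  infix 4 _≋ᵛ_
  _≋ᵛ_ : ℤ² → ℤ² → Set
  (α , γ) ≋ᵛ (α' , γ') = α ≋ α' Σ.× γ ≋ γ'

  ≋ᵛ-refl : ∀ {p} → p ≋ᵛ p
  ≋ᵛ-refl = ≋-refl , ≋-refl

  ≋ᵛ-sym : ∀ {p q} → p ≋ᵛ q → q ≋ᵛ p
  ≋ᵛ-sym (α≋ , γ≋) = ≋-sym α≋ , ≋-sym γ≋

  +ᵛ-cong : ∀ {p p' q q'} → p ≋ᵛ p' → q ≋ᵛ q' → p +ᵛ q ≋ᵛ p' +ᵛ q'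
  +ᵛ-cong (α≋ , γ≋) (β≋ , δ≋) = +-cong-≋ α≋ β≋ , +-cong-≋ γ≋ δ≋

  -ᵛ-cong : ∀ {p p'} → p ≋ᵛ p' → -ᵛ p ≋ᵛ -ᵛ p'
  -ᵛ-cong (α≋ , γ≋) = neg-cong-≋ α≋ , neg-cong-≋ γ≋

  det-cong : ∀ {p p' q q'} → p ≋ᵛ p' → q ≋ᵛ q' → det (p , q) ≋ det (p' , q')
  det-cong (α≋ , γ≋) (β≋ , δ≋) = +-cong-≋ (*-cong-≋ α≋ δ≋) (neg-cong-≋ (*-cong-≋ γ≋ β≋))

  SL₂ : Mat₂ → Set
  SL₂ g = det g ≋ ℤ.1ℤ

  SL₂? : ∀ g → Dec (SL₂ g)
  SL₂? g = Dec.map′ mod-∣ ∣-difference (+ n ∣? det g ℤ.- ℤ.1ℤ)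

  SL₂-cong : ∀ {p p' q q'} → p ≋ᵛ p' → q ≋ᵛ q' → SL₂ (p , q) → SL₂ (p' , q')
  SL₂-cong p≋ q≋ = ≋-trans (≋-sym (det-cong p≋ q≋))

  SL₂-det : ∀ {g g'} → det g ≡ det g' → SL₂ g → SL₂ g'
  SL₂-det {g} {g'} eq = ≡.subst (_≋ ℤ.1ℤ) eq

  SL₂-rot : ∀ g → SL₂ g → SL₂ (rot g)
  SL₂-rot g = SL₂-det {g} {rot g} (≡.sym (det-rot g))

  SL₂-tri : ∀ g → SL₂ g → SL₂ (tri g)
  SL₂-tri g = SL₂-det {g} {tri g} (≡.sym (det-tri g))

module IntegerMultiples (A : AbelianGroup c ℓ) where
  open AbelianGroup A
  open import Algebra.Properties.Group group using (⁻¹-involutive; ε⁻¹≈ε)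
  open import Algebra.Properties.AbelianGroup A using (⁻¹-∙-comm)
  open import Algebra.Properties.Monoid.Mult monoid public using (_×_; ×-homo-+; ×-assocˡ; ×-congʳ; ×-homo-1)
  open import Algebra.Properties.CommutativeMonoid.Mult commutativeMonoid using (×-distrib-+)
  open import Algebra.Properties.CommutativeSemigroup commutativeSemigroup using (interchange)
  open import Relation.Binary.Reasoning.Setoid setoid

  infixr 7.5 _⊙_
  _⊙_ : ℤ → Carrier → Carrier
  + n      ⊙ x = n × x
  -[1+ n ] ⊙ x = (suc n × x) ⁻¹

  ⊙-congʳ : ∀ z {x y} → x ≈ y → z ⊙ x ≈ z ⊙ y
  ⊙-congʳ (+ n)      x≈y = ×-congʳ n x≈y
  ⊙-congʳ -[1+ n ]   x≈y = ⁻¹-cong (×-congʳ (suc n) x≈y)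

  ×-ε : ∀ n → n × ε ≈ ε
  ×-ε zero    = refl
  ×-ε (suc n) = trans (identityˡ _) (×-ε n)

  ⊙-ε : ∀ z → z ⊙ ε ≈ ε
  ⊙-ε (+ n)      = ×-ε n
  ⊙-ε -[1+ n ]   = trans (⁻¹-cong (×-ε (suc n))) ε⁻¹≈ε

  ⊖-⊙ : ∀ m n x → (m ⊖ n) ⊙ x ≈ m × x ∙ (n × x) ⁻¹
  ⊖-⊙ zero    zero    x = sym (trans (identityˡ _) ε⁻¹≈ε)
  ⊖-⊙ zero    (suc n) x = sym (identityˡ _)
  ⊖-⊙ (suc m) zero    x = sym (trans (∙-congˡ ε⁻¹≈ε) (identityʳ _))
  ⊖-⊙ (suc m) (suc n) x = begin
    (suc m ⊖ suc n) ⊙ x               ≡⟨ ≡.cong (_⊙ x) (ℤ.[1+m]⊖[1+n]≡m⊖n m n) ⟩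
    (m ⊖ n) ⊙ x                       ≈⟨ ⊖-⊙ m n x ⟩
    m × x ∙ (n × x) ⁻¹                ≈⟨ cancel ⟩
    (x ∙ m × x) ∙ (x ∙ n × x) ⁻¹      ∎
    where
    cancel : m × x ∙ (n × x) ⁻¹ ≈ (x ∙ m × x) ∙ (x ∙ n × x) ⁻¹
    cancel = begin
      m × x ∙ (n × x) ⁻¹                       ≈⟨ identityˡ _ ⟨
      ε ∙ (m × x ∙ (n × x) ⁻¹)                 ≈⟨ ∙-congʳ (inverseʳ x) ⟨
      (x ∙ x ⁻¹) ∙ (m × x ∙ (n × x) ⁻¹)        ≈⟨ interchange x (x ⁻¹) (m × x) ((n × x) ⁻¹) ⟩
      (x ∙ m × x) ∙ (x ⁻¹ ∙ (n × x) ⁻¹)        ≈⟨ ∙-congˡ (⁻¹-∙-comm x (n × x)) ⟩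
      (x ∙ m × x) ∙ (x ∙ n × x) ⁻¹             ∎

  ⊙-homo-+ : ∀ z w x → (z ℤ.+ w) ⊙ x ≈ z ⊙ x ∙ w ⊙ x
  ⊙-homo-+ (+ m)      (+ n)      x = ×-homo-+ x m n
  ⊙-homo-+ (+ m)      -[1+ n ]   x = ⊖-⊙ m (suc n) x
  ⊙-homo-+ -[1+ m ]   (+ n)      x = trans (⊖-⊙ n (suc m) x) (comm _ _)
  ⊙-homo-+ -[1+ m ]   -[1+ n ]   x = begin
    (suc (suc (m ℕ.+ n)) × x) ⁻¹          ≡⟨ ≡.cong (λ k → (suc k × x) ⁻¹) (ℕ.+-suc m n) ⟨
    ((suc m ℕ.+ suc n) × x) ⁻¹            ≈⟨ ⁻¹-cong (×-homo-+ x (suc m) (suc n)) ⟩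
    (suc m × x ∙ suc n × x) ⁻¹            ≈⟨ ⁻¹-∙-comm _ _ ⟨
    (suc m × x) ⁻¹ ∙ (suc n × x) ⁻¹       ∎

  ⊙-homo-neg : ∀ z x → (ℤ.- z) ⊙ x ≈ (z ⊙ x) ⁻¹
  ⊙-homo-neg (+ zero)   x = sym ε⁻¹≈ε
  ⊙-homo-neg (+ suc n)  x = refl
  ⊙-homo-neg -[1+ n ]   x = sym (⁻¹-involutive _)

  ×-⊙-assoc : ∀ n w x → (+ n ℤ.* w) ⊙ x ≈ n × (w ⊙ x)
  ×-⊙-assoc zero    w x = reflexive (≡.cong (_⊙ x) (ℤ.*-zeroˡ w))
  ×-⊙-assoc (suc n) w x = begin
    (+ suc n ℤ.* w) ⊙ x          ≡⟨ ≡.cong (_⊙ x) (ℤ.suc-* (+ n) w) ⟩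
    (w ℤ.+ + n ℤ.* w) ⊙ x        ≈⟨ ⊙-homo-+ w (+ n ℤ.* w) x ⟩
    w ⊙ x ∙ (+ n ℤ.* w) ⊙ x      ≈⟨ ∙-congˡ (×-⊙-assoc n w x) ⟩
    w ⊙ x ∙ n × (w ⊙ x)          ∎

  ⊙-assoc : ∀ z w x → (z ℤ.* w) ⊙ x ≈ z ⊙ (w ⊙ x)
  ⊙-assoc (+ n)      w x = ×-⊙-assoc n w x
  ⊙-assoc -[1+ n ]   w x = begin
    (-[1+ n ] ℤ.* w) ⊙ x          ≡⟨ ≡.cong (_⊙ x) (ℤ.neg-distribˡ-* (+ suc n) w) ⟨
    (ℤ.- (+ suc n ℤ.* w)) ⊙ x     ≈⟨ ⊙-homo-neg (+ suc n ℤ.* w) x ⟩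
    ((+ suc n ℤ.* w) ⊙ x) ⁻¹      ≈⟨ ⁻¹-cong (×-⊙-assoc (suc n) w x) ⟩
    (suc n × (w ⊙ x)) ⁻¹          ∎

  ⊙-distrib-∙ : ∀ z x y → z ⊙ (x ∙ y) ≈ z ⊙ x ∙ z ⊙ y
  ⊙-distrib-∙ (+ n)      x y = ×-distrib-+ x y n
  ⊙-distrib-∙ -[1+ n ]   x y =
    trans (⁻¹-cong (×-distrib-+ x y (suc n))) (sym (⁻¹-∙-comm _ _))

  ⊙-periodic : ∀ {n x} → n × x ≈ ε → ∀ {z w} → Congruence._≋_ n z w → z ⊙ x ≈ w ⊙ x
  ⊙-periodic {n} {x} nx≈ε {z} {w} (Congruence.mod-∣ (divides k z-w≡kn)) = begin
    z ⊙ x                        ≡⟨ ≡.cong (_⊙ x) z≡w+kn ⟩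
    (w ℤ.+ k ℤ.* + n) ⊙ x        ≈⟨ ⊙-homo-+ w (k ℤ.* + n) x ⟩
    w ⊙ x ∙ (k ℤ.* + n) ⊙ x      ≈⟨ ∙-congˡ (⊙-assoc k (+ n) x) ⟩
    w ⊙ x ∙ k ⊙ (n × x)          ≈⟨ ∙-congˡ (trans (⊙-congʳ k nx≈ε) (⊙-ε k)) ⟩
    w ⊙ x ∙ ε                    ≈⟨ identityʳ _ ⟩
    w ⊙ x                        ∎
    where
    z≡w+kn : z ≡ w ℤ.+ k ℤ.* + n
    z≡w+kn = ≡.trans (shift z w) (≡.cong (λ d → w ℤ.+ d) z-w≡kn)
      where
      shift : ∀ z w → z ≡ w ℤ.+ (z ℤ.- w)
      shift = solve-∀


module FiniteTorsion (A : AbelianGroup c ℓ) where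
  open AbelianGroup A
  open IntegerMultiples A using (_×_; ×-homo-+; ×-assocˡ; ×-congʳ; ×-ε)
  open import Algebra.Properties.Group group using (identityʳ-unique)
  open import Function.Bundles using (Surjection)
  open import Relation.Binary.Reasoning.Setoid setoid

  finite⇒torsion : Finite A → ∀ x → ∃ λ n → suc n × x ≈ ε
  finite⇒torsion (k , surjection) x = torsion (Fin.pigeonhole (ℕ.n<1+n k) index)
    where
    open Surjection surjection
    index : Fin (suc k) → Fin k
    index i = Σ.proj₁ (surjective (toℕ i × x))
    to-index : ∀ i → to (index i) ≈ toℕ i × x
    to-index i = Σ.proj₂ (surjective (toℕ i × x)) ≡.refl
    torsion : (∃₂ λ i j → i Fin.< j Σ.× index i ≡ index j) → ∃ λ n → suc n × x ≈ ε
    torsion (i , j , i<j , same-index) = n , identityʳ-unique (toℕ i × x) (suc n × x) (begin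
      toℕ i × x ∙ suc n × x   ≈⟨ ×-homo-+ x (toℕ i) (suc n) ⟨
      (toℕ i ℕ.+ suc n) × x   ≡⟨ ≡.cong (_× x) i+n+1≡j ⟩
      toℕ j × x               ≈⟨ to-index j ⟨
      to (index j)            ≡⟨ ≡.cong to same-index ⟨
      to (index i)            ≈⟨ to-index i ⟩
      toℕ i × x               ∎)
      where
      n = toℕ j ℕ.∸ suc (toℕ i)
      i+n+1≡j : toℕ i ℕ.+ suc n ≡ toℕ j
      i+n+1≡j = ≡.trans (ℕ.+-suc (toℕ i) n) (ℕ.m+[n∸m]≡n i<j)

  finite⇒common-torsion : Finite A → ∀ x y → ∃ λ n → suc n × x ≈ ε Σ.× suc n × y ≈ ε
  finite⇒common-torsion fin x y with finite⇒torsion fin x | finite⇒torsion fin y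
  ... | m , [m+1]x≈ε | n , [n+1]y≈ε =
    n ℕ.+ m ℕ.* suc n ,  -- so that the exponent is (m + 1) (n + 1)
    ≡.subst (λ e → e × x ≈ ε) (ℕ.*-comm (suc n) (suc m)) (multiple-of x (suc n) {suc m} [m+1]x≈ε) ,
    multiple-of y (suc m) {suc n} [n+1]y≈ε
    where
    multiple-of : ∀ x k {d} → d × x ≈ ε → (k ℕ.* d) × x ≈ ε
    multiple-of x k {d} dx≈ε = trans (sym (×-assocˡ x k d)) (trans (×-congʳ k dx≈ε) (×-ε k))

module ResidueSums (C : CommutativeMonoid c ℓ) (M : ℕ) where
  open CommutativeMonoid C
  open import Algebra.Properties.CommutativeMonoid.Sum C
    using (sum; sum-syntax; sum-cong-≋; sum-init-last; ∑-distrib-+; ∑-comm; ∑-permute)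
  open import Relation.Binary.Reasoning.Setoid setoid
  open Congruence (suc M)

  ι : Fin (suc M) → ℤ
  ι i = + toℕ i

  Periodic : (ℤ → Carrier) → Set ℓ
  Periodic h = ∀ {z w} → z ≋ w → h z ≈ h w

  -- opaque, so that the unifier treats ∮ h as a rigid head instead of unfolding the sum
  opaque
    ∮ : (ℤ → Carrier) → Carrier
    ∮ h = ∑[ i < suc M ] h (ι i)

    ∮-cong : ∀ {h g} → (∀ z → h z ≈ g z) → ∮ h ≈ ∮ g
    ∮-cong h≈g = sum-cong-≋ (λ i → h≈g (ι i))

    ∮-distrib : ∀ h g → ∮ (λ z → h z ∙ g z) ≈ ∮ h ∙ ∮ g
    ∮-distrib h g = ∑-distrib-+ (λ i → h (ι i)) (λ i → g (ι i))

    ∮-comm : ∀ (f : ℤ → ℤ → Carrier) → ∮ (λ z → ∮ (f z)) ≈ ∮ (λ w → ∮ (λ z → f z w))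
    ∮-comm f = ∑-comm (λ i j → f (ι i) (ι j))

    private
      ∮-translate-1 : ∀ {h} → Periodic h → ∮ (λ z → h (ℤ.1ℤ ℤ.+ z)) ≈ ∮ h
      ∮-translate-1 {h} h-per = begin
        ∑[ i < suc M ] h (+ suc (toℕ i))                       ≈⟨ sum-init-last (λ i → h (+ suc (toℕ i))) ⟩
        ∑[ i < M ] h (+ suc (toℕ (Fin.inject₁ i))) ∙ h (+ suc (toℕ (Fin.fromℕ M)))
          ≈⟨ ∙-cong (sum-cong-≋ {M} (λ i → reflexive (≡.cong (λ k → h (+ suc k)) (Fin.toℕ-inject₁ i))))
                    (reflexive (≡.cong (λ k → h (+ suc k)) (Fin.toℕ-fromℕ M))) ⟩
        ∑[ i < M ] h (+ suc (toℕ i)) ∙ h (+ suc M)             ≈⟨ ∙-congˡ (h-per modulus≋0) ⟩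
        ∑[ i < M ] h (+ suc (toℕ i)) ∙ h (+ 0)                 ≈⟨ comm _ _ ⟩
        ∮ h                                                   ∎

      ∮-translate-ℕ : ∀ n {h} → Periodic h → ∮ (λ z → h (+ n ℤ.+ z)) ≈ ∮ h
      ∮-translate-ℕ zero    {h} h-per = ∮-cong (λ z → reflexive (≡.cong h (ℤ.+-identityˡ z)))
      ∮-translate-ℕ (suc n) {h} h-per = begin
        ∮ (λ z → h (+ suc n ℤ.+ z))              ≈⟨ ∮-cong (λ z → reflexive (≡.cong h (shuffle (+ n) z))) ⟩
        ∮ (λ z → h (+ n ℤ.+ (ℤ.1ℤ ℤ.+ z)))
          ≈⟨ ∮-translate-1 {λ w → h (+ n ℤ.+ w)} (λ z≋w → h-per (+-cong-≋ (≋-refl {+ n}) z≋w)) ⟩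
        ∮ (λ z → h (+ n ℤ.+ z))                  ≈⟨ ∮-translate-ℕ n h-per ⟩
        ∮ h                                      ∎
        where
        shuffle : ∀ n z → (ℤ.1ℤ ℤ.+ n) ℤ.+ z ≡ n ℤ.+ (ℤ.1ℤ ℤ.+ z)
        shuffle = solve-∀

      ∮-translateˡ : ∀ d {h} → Periodic h → ∮ (λ z → h (d ℤ.+ z)) ≈ ∮ h
      ∮-translateˡ (+ n)      h-per = ∮-translate-ℕ n h-per
      ∮-translateˡ -[1+ n ]   {h} h-per = begin
        ∮ (λ z → h (-[1+ n ] ℤ.+ z))                    ≈⟨ ∮-translate-ℕ (suc n) h-per′ ⟨
        ∮ (λ z → h (-[1+ n ] ℤ.+ (+ suc n ℤ.+ z)))      ≈⟨ ∮-cong (λ z → reflexive (≡.cong h (cancel (+ suc n) z))) ⟩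
        ∮ h                                            ∎
        where
        h-per′ : Periodic (λ z → h (-[1+ n ] ℤ.+ z))
        h-per′ z≋w = h-per (+-cong-≋ (≋-refl { -[1+ n ] }) z≋w)
        cancel : ∀ k z → ℤ.- k ℤ.+ (k ℤ.+ z) ≡ z
        cancel = solve-∀

    ∮-translate : ∀ h → Periodic h → ∀ d → ∮ (λ z → h (z ℤ.+ d)) ≈ ∮ h
    ∮-translate h h-per d = trans (∮-cong (λ z → reflexive (≡.cong h (ℤ.+-comm z d)))) (∮-translateˡ d h-per)

    ∮-neg : ∀ h → Periodic h → ∮ (λ z → h (ℤ.- z)) ≈ ∮ h
    ∮-neg h h-per = sym (trans (∑-permute (λ i → h (ι i)) (lift₀ reverse)) (sum-cong-≋ negate))
      where
      negate : ∀ i → h (ι (lift₀ reverse ⟨$⟩ʳ i)) ≈ h (ℤ.- ι i)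
      negate Fin.zero    = refl
      negate (Fin.suc i) = h-per (mod-∣ (≡.subst (λ t → + suc M ∣ + t) (≡.sym opposite+i≡M) ∣-refl))
        where
        opposite+i≡M : suc (toℕ (Fin.opposite i)) ℕ.+ suc (toℕ i) ≡ suc M
        opposite+i≡M = ≡.cong suc (≡.trans (≡.cong (ℕ._+ suc (toℕ i)) (Fin.opposite-prop i))
                                           (ℕ.m∸n+n≡m (Fin.toℕ<n i)))

  ∮² : (ℤ² → Carrier) → Carrier
  ∮² h = ∮ λ α → ∮ λ γ → h (α , γ)

  Periodic² : (ℤ² → Carrier) → Set ℓ
  Periodic² h = ∀ {p q} → p ≋ᵛ q → h p ≈ h q

  ∮²-cong : ∀ {h g} → (∀ p → h p ≈ g p) → ∮² h ≈ ∮² g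
  ∮²-cong h≈g = ∮-cong (λ α → ∮-cong (λ γ → h≈g (α , γ)))

  ∮²-distrib : ∀ h g → ∮² (λ p → h p ∙ g p) ≈ ∮² h ∙ ∮² g
  ∮²-distrib h g = trans (∮-cong (λ α → ∮-distrib _ _)) (∮-distrib _ _)

  ∮²-comm : ∀ (f : ℤ² → ℤ² → Carrier) → ∮² (λ p → ∮² (f p)) ≈ ∮² (λ q → ∮² (λ p → f p q))
  ∮²-comm f = begin
    ∮ (λ α → ∮ λ γ → ∮ λ β → ∮ λ δ → f (α , γ) (β , δ))   ≈⟨ ∮-cong (λ α → ∮-comm _) ⟩
    ∮ (λ α → ∮ λ β → ∮ λ γ → ∮ λ δ → f (α , γ) (β , δ))   ≈⟨ ∮-comm _ ⟩
    ∮ (λ β → ∮ λ α → ∮ λ γ → ∮ λ δ → f (α , γ) (β , δ))   ≈⟨ ∮-cong (λ β → ∮-cong (λ α → ∮-comm _)) ⟩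
    ∮ (λ β → ∮ λ α → ∮ λ δ → ∮ λ γ → f (α , γ) (β , δ))   ≈⟨ ∮-cong (λ β → ∮-comm _) ⟩
    ∮ (λ β → ∮ λ δ → ∮ λ α → ∮ λ γ → f (α , γ) (β , δ))   ∎

  ∮²-translate : ∀ h → Periodic² h → ∀ d → ∮² (λ p → h (p +ᵛ d)) ≈ ∮² h
  ∮²-translate h h-per (d₁ , d₂) = begin
    ∮ (λ α → ∮ λ γ → h (α ℤ.+ d₁ , γ ℤ.+ d₂))
      ≈⟨ ∮-cong (λ α → ∮-translate (λ γ → h (α ℤ.+ d₁ , γ)) (λ γ≋ → h-per (≋-refl , γ≋)) d₂) ⟩
    ∮ (λ α → ∮ λ γ → h (α ℤ.+ d₁ , γ))
      ≈⟨ ∮-translate (λ α → ∮ λ γ → h (α , γ)) ∮-cong-≋ d₁ ⟩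
    ∮ (λ α → ∮ λ γ → h (α , γ))                 ∎
    where
    ∮-cong-≋ : ∀ {α α'} → α ≋ α' → ∮ (λ γ → h (α , γ)) ≈ ∮ (λ γ → h (α' , γ))
    ∮-cong-≋ α≋ = ∮-cong (λ γ → h-per (α≋ , ≋-refl))

  ∮²-neg : ∀ h → Periodic² h → ∮² (λ p → h (-ᵛ p)) ≈ ∮² h
  ∮²-neg h h-per = begin
    ∮ (λ α → ∮ λ γ → h (ℤ.- α , ℤ.- γ))
      ≈⟨ ∮-cong (λ α → ∮-neg (λ γ → h (ℤ.- α , γ)) (λ γ≋ → h-per (≋-refl , γ≋))) ⟩
    ∮ (λ α → ∮ λ γ → h (ℤ.- α , γ))
      ≈⟨ ∮-neg (λ α → ∮ λ γ → h (α , γ)) (λ α≋ → ∮-cong (λ γ → h-per (α≋ , ≋-refl))) ⟩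
    ∮ (λ α → ∮ λ γ → h (α , γ))           ∎

  Periodicᴹ : (Mat₂ → Carrier) → Set ℓ
  Periodicᴹ G = ∀ {p p' q q'} → p ≋ᵛ p' → q ≋ᵛ q' → G (p , q) ≈ G (p' , q')

  ∮ᴹ : (Mat₂ → Carrier) → Carrier
  ∮ᴹ G = ∮² λ p → ∮² λ q → G (p , q)

  ∮ᴹ-cong : ∀ {G H} → (∀ m → G m ≈ H m) → ∮ᴹ G ≈ ∮ᴹ H
  ∮ᴹ-cong G≈H = ∮²-cong (λ p → ∮²-cong (λ q → G≈H (p , q)))

  ∮ᴹ-distrib : ∀ G H → ∮ᴹ (λ m → G m ∙ H m) ≈ ∮ᴹ G ∙ ∮ᴹ H
  ∮ᴹ-distrib G H = trans (∮²-cong (λ p → ∮²-distrib _ _)) (∮²-distrib _ _)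

  Periodicᴹ-rot : ∀ {G} → Periodicᴹ G → Periodicᴹ (G ∘ rot)
  Periodicᴹ-rot G-per p≋ q≋ = G-per q≋ (-ᵛ-cong p≋)

  Periodicᴹ-tri : ∀ {G} → Periodicᴹ G → Periodicᴹ (G ∘ tri)
  Periodicᴹ-tri G-per p≋ q≋ = G-per (+ᵛ-cong q≋ (-ᵛ-cong p≋)) (-ᵛ-cong p≋)

  ∮ᴹ-rot : ∀ G → Periodicᴹ G → ∮ᴹ (G ∘ rot) ≈ ∮ᴹ G
  ∮ᴹ-rot G G-per = begin
    ∮² (λ p → ∮² λ q → G (q , -ᵛ p))   ≈⟨ ∮²-comm (λ p q → G (q , -ᵛ p)) ⟩
    ∮² (λ q → ∮² λ p → G (q , -ᵛ p))   ≈⟨ ∮²-cong (λ q → ∮²-neg (λ p → G (q , p)) (G-per ≋ᵛ-refl)) ⟩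
    ∮ᴹ G                               ∎

  ∮ᴹ-tri : ∀ G → Periodicᴹ G → ∮ᴹ (G ∘ tri) ≈ ∮ᴹ G
  ∮ᴹ-tri G G-per = begin
    ∮² (λ p → ∮² λ q → G (q -ᵛ p , -ᵛ p))
      ≈⟨ ∮²-cong (λ p → ∮²-translate (λ q → G (q , -ᵛ p)) (λ q≋ → G-per q≋ ≋ᵛ-refl) (-ᵛ p)) ⟩
    ∮ᴹ (G ∘ rot)                           ≈⟨ ∮ᴹ-rot G G-per ⟩
    ∮ᴹ G                                   ∎

module ResidueCounts (C : CommutativeMonoid c ℓ) (M : ℕ) where
  open CommutativeMonoid C
  open ResidueSums C M
  open import Algebra.Properties.Monoid.Mult monoid using (_×_; ×-homo-+)
  open import Relation.Binary.Reasoning.Setoid setoid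
  module # = ResidueSums ℕ.+-0-commutativeMonoid M

  opaque
    unfolding ResidueSums.∮

    ∮-× : ∀ (k : ℤ → ℕ) x → ∮ (λ z → k z × x) ≈ #.∮ k × x
    ∮-× k x = sum-× (λ i → k (ι i))
      where
      open import Algebra.Properties.CommutativeMonoid.Sum C using (sum)
      open import Algebra.Properties.CommutativeMonoid.Sum ℕ.+-0-commutativeMonoid using () renaming (sum to sumℕ)
      sum-× : ∀ {n} (t : Fin n → ℕ) → sum (λ i → t i × x) ≈ sumℕ t × x
      sum-× {zero}  t = refl
      sum-× {suc n} t = trans (∙-congˡ (sum-× (λ i → t (Fin.suc i)))) (sym (×-homo-+ x (t Fin.zero) _))

    #∮-≥ : ∀ (k : ℤ → ℕ) i → k (ι i) ℕ.≤ #.∮ k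
    #∮-≥ k i = term≤sum (λ i → k (ι i)) i
      where
      open import Algebra.Properties.CommutativeMonoid.Sum ℕ.+-0-commutativeMonoid using () renaming (sum to sumℕ)
      term≤sum : ∀ {n} (t : Fin n → ℕ) i → t i ℕ.≤ sumℕ t
      term≤sum t Fin.zero    = ℕ.m≤m+n (t Fin.zero) _
      term≤sum t (Fin.suc i) = ℕ.≤-trans (term≤sum (λ j → t (Fin.suc j)) i) (ℕ.m≤n+m _ (t Fin.zero))

  ∮ᴹ-× : ∀ {G} (k : Mat₂ → ℕ) x → (∀ m → G m ≈ k m × x) → ∮ᴹ G ≈ #.∮ᴹ k × x
  ∮ᴹ-× {G} k x G≈kx = begin
    ∮ᴹ G                                                   ≈⟨ ∮ᴹ-cong G≈kx ⟩
    ∮ (λ α → ∮ λ γ → ∮ λ β → ∮ λ δ → k ((α , γ) , (β , δ)) × x)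
      ≈⟨ ∮-cong (λ α → ∮-cong (λ γ → ∮-cong (λ β → ∮-× _ x))) ⟩
    ∮ (λ α → ∮ λ γ → ∮ λ β → #.∮ (λ δ → k ((α , γ) , (β , δ))) × x)
      ≈⟨ ∮-cong (λ α → ∮-cong (λ γ → ∮-× _ x)) ⟩
    ∮ (λ α → ∮ λ γ → #.∮ (λ β → #.∮ λ δ → k ((α , γ) , (β , δ))) × x)
      ≈⟨ ∮-cong (λ α → ∮-× _ x) ⟩
    ∮ (λ α → #.∮ (λ γ → #.∮ λ β → #.∮ λ δ → k ((α , γ) , (β , δ))) × x)
      ≈⟨ ∮-× _ x ⟩
    #.∮ᴹ k × x                                             ∎

  #∮ᴹ-≥ : ∀ (k : Mat₂ → ℕ) a b c d → k ((ι a , ι b) , (ι c , ι d)) ℕ.≤ #.∮ᴹ k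
  #∮ᴹ-≥ k a b c d =
    ℕ.≤-trans (#∮-≥ _ d) (ℕ.≤-trans (#∮-≥ _ c) (ℕ.≤-trans (#∮-≥ _ b) (#∮-≥ _ a)))

module OrbitSums (E : AbelianGroup c ℓ) (M : ℕ) where
  open AbelianGroup E
  open ResidueSums commutativeMonoid M
  open import Algebra.Properties.Group group using (identityˡ-unique)
  open import Relation.Binary.Reasoning.Setoid setoid

  rot-orbit : (Mat₂ → Carrier) → Mat₂ → Carrier
  rot-orbit G g = G g ∙ G (rot g) ∙ G (rot (rot g)) ∙ G (rot (rot (rot g)))

  tri-orbit : (Mat₂ → Carrier) → Mat₂ → Carrier
  tri-orbit G g = G g ∙ G (tri g) ∙ G (tri (tri g))

  module _ (G : Mat₂ → Carrier) (G-per : Periodicᴹ G) where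

    private
      X = ∮ᴹ G
      G∘rot-per = Periodicᴹ-rot G-per
      G∘rot²-per = Periodicᴹ-rot G∘rot-per

    ∮ᴹ-rot-orbit : ∮ᴹ (rot-orbit G) ≈ X ∙ X ∙ X ∙ X
    ∮ᴹ-rot-orbit = begin
      ∮ᴹ (rot-orbit G)
        ≈⟨ trans (∮ᴹ-distrib _ _) (∙-congʳ (trans (∮ᴹ-distrib _ _) (∙-congʳ (∮ᴹ-distrib _ _)))) ⟩
      X ∙ ∮ᴹ (G ∘ rot) ∙ ∮ᴹ (G ∘ rot ∘ rot) ∙ ∮ᴹ (G ∘ rot ∘ rot ∘ rot)
        ≈⟨ ∙-cong (∙-cong (∙-congˡ rot¹) rot²) rot³ ⟩
      X ∙ X ∙ X ∙ X ∎
      where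
      rot¹ = ∮ᴹ-rot G G-per
      rot² = trans (∮ᴹ-rot (G ∘ rot) G∘rot-per) rot¹
      rot³ = trans (∮ᴹ-rot (G ∘ rot ∘ rot) G∘rot²-per) rot²

    ∮ᴹ-tri-orbit : ∮ᴹ (tri-orbit G) ≈ X ∙ X ∙ X
    ∮ᴹ-tri-orbit = begin
      ∮ᴹ (tri-orbit G)
        ≈⟨ trans (∮ᴹ-distrib _ _) (∙-congʳ (∮ᴹ-distrib _ _)) ⟩
      X ∙ ∮ᴹ (G ∘ tri) ∙ ∮ᴹ (G ∘ tri ∘ tri)
        ≈⟨ ∙-cong (∙-congˡ tri¹) (trans (∮ᴹ-tri (G ∘ tri) (Periodicᴹ-tri G-per)) tri¹) ⟩
      X ∙ X ∙ X ∎
      where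
      tri¹ = ∮ᴹ-tri G G-per

    -- Summing the two orbit decompositions over all matrices gives 4 X = 3 X.
    ∮ᴹ-rot-orbit≈ε : (∀ g → rot-orbit G g ≈ tri-orbit G g) → ∮ᴹ (rot-orbit G) ≈ ε
    ∮ᴹ-rot-orbit≈ε orbits≈ = begin
      ∮ᴹ (rot-orbit G)   ≈⟨ ∮ᴹ-rot-orbit ⟩
      X ∙ X ∙ X ∙ X      ≈⟨ ∙-cong (∙-cong (∙-cong X≈ε X≈ε) X≈ε) X≈ε ⟩
      ε ∙ ε ∙ ε ∙ ε      ≈⟨ trans (identityʳ _) (trans (identityʳ _) (identityʳ _)) ⟩
      ε                  ∎
      where
      4X≈3X : (X ∙ X ∙ X) ∙ X ≈ X ∙ X ∙ X
      4X≈3X = trans (sym ∮ᴹ-rot-orbit) (trans (∮ᴹ-cong orbits≈) ∮ᴹ-tri-orbit)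
      X≈ε : X ≈ ε
      X≈ε = identityˡ-unique X (X ∙ X ∙ X) (trans (comm _ _) 4X≈3X)

module ModularSymbols (A : AbelianGroup c ℓ) (m : ℕ) where
  open AbelianGroup A

  open import Algebra.Properties.Group group
    using (⁻¹-involutive; ⁻¹-anti-homo-∙; //-rightDividesˡ; //-rightDividesʳ; \\-leftDividesˡ)
  open import Algebra.Properties.AbelianGroup A using (⁻¹-anti-homo‿-; xyx⁻¹≈y; ⁻¹-∙-comm)
  open import Algebra.Properties.CommutativeSemigroup commutativeSemigroup using (x∙yz≈xz∙y)

  open IntegerMultiples A using (_⊙_; _×_)

  InSpan-⊙ : ∀ {n} {t : Fin n → Carrier} k {x} → InSpan A t x → InSpan A t (k ⊙ x)
  InSpan-⊙ (+ n)      x∈ = InSpan-× n x∈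
    where
    InSpan-× : ∀ n {x} → InSpan A _ x → InSpan A _ (n × x)
    InSpan-× zero    x∈ = span-ε
    InSpan-× (suc n) x∈ = span-∙ x∈ (InSpan-× n x∈)
  InSpan-⊙ -[1+ n ]   x∈ = span-inv (InSpan-⊙ (+ suc n) x∈)

  x∙[y∙x]⁻¹≈y⁻¹ : ∀ x y → x ∙ (y ∙ x) ⁻¹ ≈ y ⁻¹
  x∙[y∙x]⁻¹≈y⁻¹ x y = trans (∙-congˡ (⁻¹-anti-homo-∙ y x)) (\\-leftDividesˡ x (y ⁻¹))

  x⁻¹-y⁻¹≈y-x : ∀ x y → x ⁻¹ - y ⁻¹ ≈ y - x
  x⁻¹-y⁻¹≈y-x x y = trans (comm _ _) (∙-congʳ (⁻¹-involutive y))

  ℳ : AbelianGroup (c ⊔ ℓ) (c ⊔ ℓ)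
  ℳ = record
    { Carrier = Expr A m ; _≈_ = _∼_ A ; _∙_ = _⊕_ ; ε = zer ; _⁻¹ = neg
    ; isAbelianGroup = record
      { isGroup = record
        { isMonoid = record
          { isSemigroup = record
            { isMagma = record
              { isEquivalence = record { refl = ∼-refl ; sym = ∼-sym ; trans = ∼-trans }
              ; ∙-cong = ⊕-cong }
            ; assoc = ⊕-assoc }
          ; identity = (λ x → ∼-trans (⊕-comm zer x) (⊕-idʳ x)) , ⊕-idʳ }
        ; inverse = (λ x → ∼-trans (⊕-comm (neg x) x) (⊕-invʳ x)) , ⊕-invʳ
        ; ⁻¹-cong = neg-cong }
      ; comm = ⊕-comm } }

  ·≡× : ∀ n e → _·_ A n e ≡ IntegerMultiples._×_ ℳ n e
  ·≡× zero    e = ≡.refl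
  ·≡× (suc n) e = ≡.cong (e ⊕_) (·≡× n e)

  Spans-transfer : ∀ {n n'} {t : Fin n → Carrier} {t' : Fin n' → Carrier} →
                   Spans A t → (∀ j → InSpan A t' (t j)) → Spans A t'
  Spans-transfer {t = t} {t'} t-spans t⊆⟨t'⟩ x = go (t-spans x)
    where
    go : ∀ {x} → InSpan A t x → InSpan A t' x
    go (span-gen j)    = t⊆⟨t'⟩ j
    go span-ε          = span-ε
    go (span-inv x∈)   = span-inv (go x∈)
    go (span-∙ x∈ y∈)  = span-∙ (go x∈) (go y∈)
    go (span-resp e x∈) = span-resp e (go x∈)

  module Symbols (r : Fin m → Carrier) where

    infix 4 _≃_ _∈⟨_,_⟩
    _≃_ : Expr A m → Expr A m → Set (c ⊔ ℓ)
    _≃_ = _∼_ A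

    Spans₂ : Carrier → Carrier → Set (c ⊔ ℓ)
    Spans₂ x y = Spans A (x ∷ y ∷ r)

    _∈⟨_,_⟩ : Carrier → Carrier → Carrier → Set (c ⊔ ℓ)
    z ∈⟨ x , y ⟩ = InSpan A (x ∷ y ∷ r) z

    fst∈ : ∀ {x y} → x ∈⟨ x , y ⟩
    fst∈ = span-gen Fin.zero

    snd∈ : ∀ {x y} → y ∈⟨ x , y ⟩
    snd∈ = span-gen (Fin.suc Fin.zero)

    respan : ∀ {x y x' y'} → Spans₂ x y → x ∈⟨ x' , y' ⟩ → y ∈⟨ x' , y' ⟩ → Spans₂ x' y'
    respan s x∈ y∈ = Spans-transfer s λ
      { Fin.zero → x∈ ; (Fin.suc Fin.zero) → y∈ ; (Fin.suc (Fin.suc j)) → span-gen (Fin.suc (Fin.suc j)) }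

    symbol : ∀ x y → Spans₂ x y → Expr A m
    symbol x y s = gen (x ∷ y ∷ r) s

    symbol-cong : ∀ {x x' y y'} (s : Spans₂ x y) (s' : Spans₂ x' y') →
                  x ≈ x' → y ≈ y' → symbol x y s ≃ symbol x' y' s'
    symbol-cong s s' x≈x' y≈y' = gen-cong s s' λ
      { Fin.zero → x≈x' ; (Fin.suc Fin.zero) → y≈y' ; (Fin.suc (Fin.suc j)) → refl }

    symbol-swap : ∀ {x y} (s : Spans₂ x y) (s' : Spans₂ y x) → symbol x y s ≃ symbol y x s'
    symbol-swap {x} {y} s s' = ∼-trans (rel-O (x ∷ y ∷ r) σ s σs) (gen-cong σs s' λ
      { Fin.zero → refl ; (Fin.suc Fin.zero) → refl ; (Fin.suc (Fin.suc j)) → refl })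
      where
      σ = transpose Fin.zero (Fin.suc Fin.zero)
      σs = Spans-transfer s' λ
        { Fin.zero → span-gen Fin.zero ; (Fin.suc Fin.zero) → span-gen (Fin.suc Fin.zero)
        ; (Fin.suc (Fin.suc j)) → span-gen (Fin.suc (Fin.suc j)) }

    Spans₂-cong : ∀ {x y x' y'} → x ≈ x' → y ≈ y' → Spans₂ x y → Spans₂ x' y'
    Spans₂-cong x≈x' y≈y' s = respan s (span-resp (sym x≈x') fst∈) (span-resp (sym y≈y') snd∈)

    Spans₂-swap : ∀ {x y} → Spans₂ x y → Spans₂ y x
    Spans₂-swap s = respan s snd∈ fst∈

    Spans₂-inv : ∀ {x y} → Spans₂ x y → Spans₂ (x ⁻¹) y
    Spans₂-inv {x} s = respan s (span-resp (⁻¹-involutive x) (span-inv fst∈)) snd∈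

    Spans₂-sub : ∀ {x y} → Spans₂ x y → Spans₂ (x - y) y
    Spans₂-sub {x} {y} s = respan s (span-resp (//-rightDividesˡ y x) (span-∙ fst∈ snd∈)) snd∈

    Spans₂-rot : ∀ {x y} → Spans₂ x y → Spans₂ y (x ⁻¹)
    Spans₂-rot s = Spans₂-swap (Spans₂-inv s)

    symbol-M : ∀ {x y x₁ y₂} (s : Spans₂ x y) (s₁ : Spans₂ x₁ y) (s₂ : Spans₂ x y₂) →
               x - y ≈ x₁ → y - x ≈ y₂ → symbol x y s ≃ symbol x₁ y s₁ ⊕ symbol x y₂ s₂
    symbol-M {x} {y} s s₁ s₂ x-y≈x₁ y-x≈y₂ =
      ∼-trans (rel-M x y r s t₁ t₂) (⊕-cong (symbol-cong t₁ s₁ x-y≈x₁ refl) (symbol-cong t₂ s₂ refl y-x≈y₂))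
      where
      t₁ = Spans₂-sub s
      t₂ = Spans₂-swap (Spans₂-sub (Spans₂-swap s))

    private
      module ℳ = AbelianGroup ℳ
      open import Relation.Binary.Reasoning.Setoid ℳ.setoid
      open import Algebra.Properties.CommutativeSemigroup ℳ.commutativeSemigroup using (xy∙z≈xz∙y)
      open import Algebra.Solver.CommutativeMonoid ℳ.commutativeMonoid using (solve) renaming (_⊕_ to _⊞_; _⊜_ to _≐_)

    signSum-cong : ∀ {x y x' y'} (s : Spans₂ x y) (s' : Spans₂ x' y') →
                   x ≈ x' → y ≈ y' → signSum A x y r s ≃ signSum A x' y' r s'
    signSum-cong s s' x≈ y≈ =
      ⊕-cong (⊕-cong (⊕-cong (symbol-cong _ _ x≈ y≈) (symbol-cong _ _ (⁻¹-cong x≈) y≈))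
                     (symbol-cong _ _ x≈ (⁻¹-cong y≈)))
             (symbol-cong _ _ (⁻¹-cong x≈) (⁻¹-cong y≈))

    signSum≃rot-orbit : ∀ {x y} (s : Spans₂ x y) (s₁ : Spans₂ y (x ⁻¹)) (s₂ : Spans₂ (x ⁻¹) (y ⁻¹))
                        (s₃ : Spans₂ (y ⁻¹) x) →
                        signSum A x y r s ≃
                        symbol x y s ⊕ symbol y (x ⁻¹) s₁ ⊕ symbol (x ⁻¹) (y ⁻¹) s₂ ⊕ symbol (y ⁻¹) x s₃
    signSum≃rot-orbit s s₁ s₂ s₃ =
      ∼-trans (⊕-cong (⊕-cong (⊕-cong ∼-refl (symbol-swap _ s₁)) (symbol-swap _ s₃)) (symbol-cong _ s₂ refl refl))
              (xy∙z≈xz∙y _ _ _)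

    signSum-swap : ∀ {x y} (s : Spans₂ x y) (s' : Spans₂ y x) → signSum A x y r s ≃ signSum A y x r s'
    signSum-swap s s' =
      ∼-trans (⊕-cong (⊕-cong (⊕-cong (symbol-swap _ _) (symbol-swap _ _)) (symbol-swap _ _)) (symbol-swap _ _))
              (⊕-cong (xy∙z≈xz∙y _ _ _) ∼-refl)

    signSum-inv : ∀ {x y} (s : Spans₂ x y) (s' : Spans₂ (x ⁻¹) y) → signSum A x y r s ≃ signSum A (x ⁻¹) y r s'
    signSum-inv {x} s s' =
      ∼-trans (xy∙z≈xz∙y _ _ _)
      (∼-trans (⊕-cong (⊕-cong (ℳ.comm _ _) ∼-refl) ∼-refl)
               (⊕-cong (⊕-cong (⊕-cong (symbol-cong _ _ refl refl) (symbol-cong _ _ x≈x⁻¹⁻¹ refl))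
                               (symbol-cong _ _ refl refl))
                       (symbol-cong _ _ x≈x⁻¹⁻¹ refl)))
      where
      x≈x⁻¹⁻¹ = sym (⁻¹-involutive x)

    signSum-rot : ∀ {x y} (s : Spans₂ x y) (s' : Spans₂ y (x ⁻¹)) → signSum A x y r s ≃ signSum A y (x ⁻¹) r s'
    signSum-rot s s' = ∼-trans (signSum-inv s (Spans₂-inv s)) (signSum-swap _ s')

    halfOrbit : ∀ x y → Spans₂ x y → Expr A m
    halfOrbit x y s = symbol x y s ⊕ symbol y (x ⁻¹) (Spans₂-rot s)

    halfOrbit-cong : ∀ {x y x' y'} (s : Spans₂ x y) (s' : Spans₂ x' y') →
                     x ≈ x' → y ≈ y' → halfOrbit x y s ≃ halfOrbit x' y' s'
    halfOrbit-cong s s' x≈ y≈ = ⊕-cong (symbol-cong s s' x≈ y≈) (symbol-cong _ _ y≈ (⁻¹-cong x≈))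

    -- two instances of (M), at (x, y) and at (y, y - x)
    halfOrbit-sub : ∀ {x y} (s : Spans₂ x y) (s' : Spans₂ (x - y) y) → halfOrbit x y s ≃ halfOrbit (x - y) y s'
    halfOrbit-sub {x} {y} s s' = begin
      symbol x y s ⊕ symbol y (x ⁻¹) _                         ≈⟨ ⊕-cong (symbol-M s s' t refl refl) ∼-refl ⟩
      symbol (x - y) y s' ⊕ symbol x (y - x) t ⊕ symbol y (x ⁻¹) _  ≈⟨ ℳ.assoc _ _ _ ⟩
      symbol (x - y) y s' ⊕ (symbol x (y - x) t ⊕ symbol y (x ⁻¹) _)
        ≈⟨ ⊕-cong ∼-refl (symbol-M t′ t (Spans₂-rot s) y-[y-x]≈x [y-x]-y≈x⁻¹) ⟨
      symbol (x - y) y s' ⊕ symbol y (y - x) t′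
        ≈⟨ ⊕-cong ∼-refl (symbol-cong _ _ refl (sym (⁻¹-anti-homo‿- x y))) ⟩
      halfOrbit (x - y) y s'                                   ∎
      where
      t  = Spans₂-swap (Spans₂-sub (Spans₂-swap s))
      y-[y-x]≈x : y - (y - x) ≈ x
      y-[y-x]≈x = trans (∙-congˡ (⁻¹-cong (comm y (x ⁻¹)))) (trans (x∙[y∙x]⁻¹≈y⁻¹ y (x ⁻¹)) (⁻¹-involutive x))
      [y-x]-y≈x⁻¹ : (y - x) - y ≈ x ⁻¹
      [y-x]-y≈x⁻¹ = xyx⁻¹≈y y (x ⁻¹)
      t′ = respan s (span-resp y-[y-x]≈x (span-∙ fst∈ (span-inv snd∈))) fst∈

    signSum≃halfOrbits : ∀ {x y} (s : Spans₂ x y) (s' : Spans₂ (x ⁻¹) (y ⁻¹)) →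
                         signSum A x y r s ≃ halfOrbit x y s ⊕ halfOrbit (x ⁻¹) (y ⁻¹) s'
    signSum≃halfOrbits {x} {y} s s' =
      ∼-trans (signSum≃rot-orbit s (Spans₂-rot s) s' (Spans₂-inv (Spans₂-swap s)))
      (∼-trans (⊕-cong (⊕-cong ∼-refl ∼-refl) (symbol-cong _ _ refl (sym (⁻¹-involutive x)))) (ℳ.assoc _ _ _))

    signSum-sub : ∀ {x y} (s : Spans₂ x y) (s' : Spans₂ (x - y) y) → signSum A x y r s ≃ signSum A (x - y) y r s'
    signSum-sub {x} {y} s s' = begin
      signSum A x y r s
        ≈⟨ signSum≃halfOrbits s s⁻ ⟩
      halfOrbit x y s ⊕ halfOrbit (x ⁻¹) (y ⁻¹) s⁻
        ≈⟨ ⊕-cong (halfOrbit-sub s s') (halfOrbit-sub s⁻ (Spans₂-sub s⁻)) ⟩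
      halfOrbit (x - y) y s' ⊕ halfOrbit (x ⁻¹ - y ⁻¹) (y ⁻¹) _
        ≈⟨ ⊕-cong ∼-refl (halfOrbit-cong _ s′⁻ (⁻¹-∙-comm x (y ⁻¹)) refl) ⟩
      halfOrbit (x - y) y s' ⊕ halfOrbit ((x - y) ⁻¹) (y ⁻¹) s′⁻
        ≈⟨ signSum≃halfOrbits s' s′⁻ ⟨
      signSum A (x - y) y r s' ∎
      where
      s⁻  = Spans₂-swap (Spans₂-inv (Spans₂-swap (Spans₂-inv s)))
      s′⁻ = Spans₂-swap (Spans₂-inv (Spans₂-swap (Spans₂-inv s')))

    -- three instances of (M), at (x⁻¹ , y⁻¹), (y - x , x⁻¹) and (y⁻¹ , x - y)
    signSum≃tri-orbit : ∀ {x y} (s : Spans₂ x y) (s₁ : Spans₂ (y - x) (x ⁻¹)) (s₂ : Spans₂ (y ⁻¹) (x - y)) →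
                        signSum A x y r s ≃ symbol x y s ⊕ symbol (y - x) (x ⁻¹) s₁ ⊕ symbol (y ⁻¹) (x - y) s₂
    signSum≃tri-orbit {x} {y} s s₁ s₂ = begin
      signSum A x y r s
        ≈⟨ signSum≃rot-orbit s sᵇ sᵈ sᵉ ⟩
      ⟨x,y⟩ ⊕ ⟨y,x⁻¹⟩ ⊕ ⟨x⁻¹,y⁻¹⟩ ⊕ ⟨y⁻¹,x⟩
        ≈⟨ ⊕-cong (⊕-cong ∼-refl (symbol-M sᵈ sᶜ sᶜ′ (x⁻¹-y⁻¹≈y-x x y) (x⁻¹-y⁻¹≈y-x y x))) ∼-refl ⟩
      ⟨x,y⟩ ⊕ ⟨y,x⁻¹⟩ ⊕ (⟨y-x,y⁻¹⟩ ⊕ ⟨x⁻¹,x-y⟩) ⊕ ⟨y⁻¹,x⟩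
        ≈⟨ solve 5 (λ a b c c′ e → ((a ⊞ b) ⊞ (c ⊞ c′)) ⊞ e ≐ (a ⊞ (b ⊞ c)) ⊞ (c′ ⊞ e)) ∼-refl
                   ⟨x,y⟩ ⟨y,x⁻¹⟩ ⟨y-x,y⁻¹⟩ ⟨x⁻¹,x-y⟩ ⟨y⁻¹,x⟩ ⟩
      ⟨x,y⟩ ⊕ (⟨y,x⁻¹⟩ ⊕ ⟨y-x,y⁻¹⟩) ⊕ (⟨x⁻¹,x-y⟩ ⊕ ⟨y⁻¹,x⟩)
        ≈⟨ ⊕-cong (⊕-cong ∼-refl (symbol-M s₁ sᵇ sᶜ (//-rightDividesʳ (x ⁻¹) y) (x∙[y∙x]⁻¹≈y⁻¹ (x ⁻¹) y)))
                  (symbol-M s₂ sᶜ′ sᵉ (x∙[y∙x]⁻¹≈y⁻¹ (y ⁻¹) x) (//-rightDividesʳ (y ⁻¹) x)) ⟨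
      ⟨x,y⟩ ⊕ symbol (y - x) (x ⁻¹) s₁ ⊕ symbol (y ⁻¹) (x - y) s₂ ∎
      where
      sᵇ = Spans₂-rot s
      sᵈ = Spans₂-swap (Spans₂-inv (Spans₂-rot s))
      sᵉ = Spans₂-inv (Spans₂-swap s)
      sᶜ = Spans₂-cong refl (x∙[y∙x]⁻¹≈y⁻¹ (x ⁻¹) y) (Spans₂-swap (Spans₂-sub (Spans₂-swap s₁)))
      sᶜ′ = Spans₂-cong (x∙[y∙x]⁻¹≈y⁻¹ (y ⁻¹) x) refl (Spans₂-sub s₂)
      ⟨x,y⟩ = symbol x y s
      ⟨y,x⁻¹⟩ = symbol y (x ⁻¹) sᵇ
      ⟨y-x,y⁻¹⟩ = symbol (y - x) (y ⁻¹) sᶜ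
      ⟨x⁻¹,x-y⟩ = symbol (x ⁻¹) (x - y) sᶜ′
      ⟨x⁻¹,y⁻¹⟩ = symbol (x ⁻¹) (y ⁻¹) sᵈ
      ⟨y⁻¹,x⟩ = symbol (y ⁻¹) x sᵉ

    Spans₂-shear : ∀ {x y} k → Spans₂ x y → Spans₂ (x ∙ k ⊙ y) y
    Spans₂-shear {x} {y} k s =
      respan s (span-resp (//-rightDividesʳ (k ⊙ y) x) (span-∙ fst∈ (span-inv (InSpan-⊙ k snd∈)))) snd∈

    signSum-shear-ℕ : ∀ {x y} n (s : Spans₂ x y) (s' : Spans₂ (x ∙ n × y) y) →
                      signSum A x y r s ≃ signSum A (x ∙ n × y) y r s'
    signSum-shear-ℕ zero    s s' = signSum-cong s s' (sym (identityʳ _)) refl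
    signSum-shear-ℕ {x} {y} (suc n) s s' =
      ∼-trans (signSum-shear-ℕ n s sₙ)
              (∼-sym (∼-trans (signSum-sub s' (Spans₂-sub s')) (signSum-cong _ sₙ cancel refl)))
      where
      sₙ = Spans₂-shear (+ n) s
      cancel : x ∙ (y ∙ n × y) - y ≈ x ∙ n × y
      cancel = trans (∙-congʳ (x∙yz≈xz∙y x y (n × y))) (//-rightDividesʳ y (x ∙ n × y))

    signSum-shear : ∀ {x y} k (s : Spans₂ x y) (s' : Spans₂ (x ∙ k ⊙ y) y) →
                    signSum A x y r s ≃ signSum A (x ∙ k ⊙ y) y r s'
    signSum-shear (+ n)              s s' = signSum-shear-ℕ n s s'
    signSum-shear {x} {y} -[1+ n ]   s s' =
      ∼-trans (signSum-inv s s⁻)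
      (∼-trans (signSum-shear-ℕ (suc n) s⁻ s⁻ₙ)
      (∼-trans (signSum-inv s⁻ₙ (Spans₂-inv s⁻ₙ))
               (signSum-cong _ s' x⁻¹∙w≈x∙w⁻¹ refl)))
      where
      s⁻ = Spans₂-inv s
      s⁻ₙ = Spans₂-shear (+ suc n) s⁻
      x⁻¹∙w≈x∙w⁻¹ : (x ⁻¹ ∙ suc n × y) ⁻¹ ≈ x ∙ (suc n × y) ⁻¹
      x⁻¹∙w≈x∙w⁻¹ = trans (sym (⁻¹-∙-comm (x ⁻¹) _)) (∙-congʳ (⁻¹-involutive x))

module SignSumTorsion (A : AbelianGroup c ℓ) (m : ℕ) (r : Fin m → AbelianGroup.Carrier A) where
  open AbelianGroup A
  open IntegerMultiples A using (_⊙_; _×_; ×-homo-1; ⊙-periodic; ⊙-homo-+; ⊙-homo-neg; ⊙-assoc; ⊙-distrib-∙)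
  open ModularSymbols A m
  open Symbols r
  open import Algebra.Properties.AbelianGroup A using (⁻¹-∙-comm; ⁻¹-involutive; ⁻¹-anti-homo‿-)
  open import Algebra.Properties.CommutativeSemigroup commutativeSemigroup using (interchange)
  open import Data.Empty using (⊥-elim)
  open import Data.Sum using ([_,_]′)
  private module ℳ = AbelianGroup ℳ

  module _ (M : ℕ) (a b : Carrier) (a-torsion : suc M × a ≈ ε) (b-torsion : suc M × b ≈ ε)
           (s : Spans₂ a b) where
    open Congruence (suc M)
    open ResidueSums ℳ.commutativeMonoid M using (Periodicᴹ; ∮ᴹ)
    open OrbitSums ℳ M
    open ResidueCounts ℳ.commutativeMonoid M using (module #; ∮ᴹ-×; #∮ᴹ-≥)
    open import Algebra.Properties.Monoid.Mult ℳ.monoid using () renaming (_×_ to _×ᴹ_)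

    -- the matrix (p , q) stands for the pair (U p , U q), coordinates taken in the basis (a , b)
    U : ℤ² → Carrier
    U (α , γ) = α ⊙ a ∙ γ ⊙ b

    U-periodic : ∀ {p q} → p ≋ᵛ q → U p ≈ U q
    U-periodic (α≋ , γ≋) = ∙-cong (⊙-periodic a-torsion α≋) (⊙-periodic b-torsion γ≋)

    U-+ : ∀ p q → U (p +ᵛ q) ≈ U p ∙ U q
    U-+ (α , γ) (β , δ) = trans (∙-cong (⊙-homo-+ α β a) (⊙-homo-+ γ δ b)) (interchange _ _ _ _)

    U-· : ∀ k p → U (k ·ᵛ p) ≈ k ⊙ U p
    U-· k (α , γ) = trans (∙-cong (⊙-assoc k α a) (⊙-assoc k γ b)) (sym (⊙-distrib-∙ k _ _))

    U-neg : ∀ p → U (-ᵛ p) ≈ U p ⁻¹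
    U-neg (α , γ) = trans (∙-cong (⊙-homo-neg α a) (⊙-homo-neg γ b)) (⁻¹-∙-comm _ _)

    U-sub : ∀ p q → U (p -ᵛ q) ≈ U p - U q
    U-sub p q = trans (U-+ p (-ᵛ q)) (∙-congˡ (U-neg q))

    U-e₁ : U (ℤ.1ℤ , ℤ.0ℤ) ≈ a
    U-e₁ = trans (identityʳ _) (×-homo-1 a)

    U-e₂ : U (ℤ.0ℤ , ℤ.1ℤ) ≈ b
    U-e₂ = trans (identityˡ _) (×-homo-1 b)

    U-combination : ∀ k l p q → k ⊙ U p ∙ l ⊙ U q ≈ U (k ·ᵛ p +ᵛ l ·ᵛ q)
    U-combination k l p q = sym (trans (U-+ (k ·ᵛ p) (l ·ᵛ q)) (∙-cong (U-· k p) (U-· l q)))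

    opaque
      spans-SL₂ : ∀ p q → SL₂ (p , q) → Spans₂ (U p) (U q)
      spans-SL₂ p@(α , γ) q@(β , δ) det≋1 =
        respan s (combination∈ δ (ℤ.- γ) a-coefficients U-e₁) (combination∈ (ℤ.- β) α b-coefficients U-e₂)
        where
        combination∈ : ∀ k l {t e} → k ·ᵛ p +ᵛ l ·ᵛ q ≋ᵛ t → U t ≈ e → e ∈⟨ U p , U q ⟩
        combination∈ k l t≋ Ut≈e = span-resp (trans (U-combination k l p q) (trans (U-periodic t≋) Ut≈e))
                                            (span-∙ (InSpan-⊙ k fst∈) (InSpan-⊙ l snd∈))
        ring₁ : ∀ α β γ δ → δ ℤ.* α ℤ.+ ℤ.- γ ℤ.* β ≡ α ℤ.* δ ℤ.- γ ℤ.* β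
        ring₁ = solve-∀
        ring₂ : ∀ γ δ → δ ℤ.* γ ℤ.+ ℤ.- γ ℤ.* δ ≡ ℤ.0ℤ
        ring₂ = solve-∀
        ring₃ : ∀ α β → ℤ.- β ℤ.* α ℤ.+ α ℤ.* β ≡ ℤ.0ℤ
        ring₃ = solve-∀
        ring₄ : ∀ α β γ δ → ℤ.- β ℤ.* γ ℤ.+ α ℤ.* δ ≡ α ℤ.* δ ℤ.- γ ℤ.* β
        ring₄ = solve-∀
        a-coefficients : δ ·ᵛ p +ᵛ (ℤ.- γ) ·ᵛ q ≋ᵛ (ℤ.1ℤ , ℤ.0ℤ)
        a-coefficients = ≋-trans (≋-reflexive (ring₁ α β γ δ)) det≋1 , ≋-reflexive (ring₂ γ δ)
        b-coefficients : (ℤ.- β) ·ᵛ p +ᵛ α ·ᵛ q ≋ᵛ (ℤ.0ℤ , ℤ.1ℤ)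
        b-coefficients = ≋-reflexive (ring₃ α β) , ≋-trans (≋-reflexive (ring₄ α β γ δ)) det≋1

    ⟪_⟫ : Mat₂ → Expr A m
    ⟪ p , q ⟫ = symbol-on (SL₂? (p , q))
      where
      symbol-on : Dec (SL₂ (p , q)) → Expr A m
      symbol-on (yes det≋1) = symbol (U p) (U q) (spans-SL₂ p q det≋1)
      symbol-on (no _)      = zer

    ⟪⟫-SL₂ : ∀ p q {x y} → SL₂ (p , q) → (sxy : Spans₂ x y) →
             U p ≈ x → U q ≈ y → ⟪ p , q ⟫ ≃ symbol x y sxy
    ⟪⟫-SL₂ p q det≋1 sxy Up≈x Uq≈y with SL₂? (p , q)
    ... | yes _    = symbol-cong _ sxy Up≈x Uq≈y
    ... | no det≉1 = ⊥-elim (det≉1 det≋1)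

    ⟪⟫-¬SL₂ : ∀ g → ¬ SL₂ g → ⟪ g ⟫ ≃ zer
    ⟪⟫-¬SL₂ g det≉1 with SL₂? g
    ... | yes det≋1 = ⊥-elim (det≉1 det≋1)
    ... | no _      = ∼-refl

    ⟪⟫-periodic : Periodicᴹ ⟪_⟫
    ⟪⟫-periodic {p} {p'} {q} {q'} p≋ q≋ = [ on-SL₂ , off-SL₂ ]′ (Dec.toSum (SL₂? (p , q)))
      where
      on-SL₂ : SL₂ (p , q) → ⟪ p , q ⟫ ≃ ⟪ p' , q' ⟫
      on-SL₂ det≋1 = ∼-trans (⟪⟫-SL₂ p q det≋1 s′ refl refl)
        (∼-sym (⟪⟫-SL₂ p' q' (SL₂-cong p≋ q≋ det≋1) s′ (U-periodic (≋ᵛ-sym p≋)) (U-periodic (≋ᵛ-sym q≋))))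
        where s′ = spans-SL₂ p q det≋1
      off-SL₂ : ¬ SL₂ (p , q) → ⟪ p , q ⟫ ≃ ⟪ p' , q' ⟫
      off-SL₂ det≉1 =
        ∼-trans (⟪⟫-¬SL₂ _ det≉1) (∼-sym (⟪⟫-¬SL₂ _ (det≉1 ∘ SL₂-cong (≋ᵛ-sym p≋) (≋ᵛ-sym q≋))))

    signSumᴹ : ∀ g → SL₂ g → Expr A m
    signSumᴹ (p , q) det≋1 = signSum A (U p) (U q) r (spans-SL₂ p q det≋1)

    rot-orbit-SL₂ : ∀ {p q} (det≋1 : SL₂ (p , q)) → rot-orbit ⟪_⟫ (p , q) ≃ signSumᴹ (p , q) det≋1
    rot-orbit-SL₂ {p} {q} det≋1 = ∼-sym (∼-trans (signSum≃rot-orbit s₀ s₁ s₂ s₃)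
      (∼-sym (⊕-cong (⊕-cong (⊕-cong (⟪⟫-SL₂ p q det≋1 s₀ refl refl)
                                      (⟪⟫-SL₂ q (-ᵛ p) h₁ s₁ refl (U-neg p)))
                              (⟪⟫-SL₂ (-ᵛ p) (-ᵛ q) h₂ s₂ (U-neg p) (U-neg q)))
                      (⟪⟫-SL₂ (-ᵛ q) (-ᵛ -ᵛ p) h₃ s₃ (U-neg q) U--p≈Up))))
      where
      s₀ = spans-SL₂ p q det≋1
      s₁ = Spans₂-rot s₀
      s₂ = Spans₂-rot s₁
      s₃ = Spans₂-cong refl (⁻¹-involutive (U p)) (Spans₂-rot s₂)
      h₁ = SL₂-rot (p , q) det≋1
      h₂ = SL₂-rot (q , -ᵛ p) h₁
      h₃ = SL₂-rot (-ᵛ p , -ᵛ q) h₂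
      U--p≈Up : U (-ᵛ -ᵛ p) ≈ U p
      U--p≈Up = trans (U-neg (-ᵛ p)) (trans (⁻¹-cong (U-neg p)) (⁻¹-involutive (U p)))

    tri-orbit-SL₂ : ∀ {p q} (det≋1 : SL₂ (p , q)) → tri-orbit ⟪_⟫ (p , q) ≃ signSumᴹ (p , q) det≋1
    tri-orbit-SL₂ {p@(α , γ)} {q@(β , δ)} det≋1 = ∼-sym (∼-trans (signSum≃tri-orbit s₀ s₁ s₂)
      (∼-sym (⊕-cong (⊕-cong (⟪⟫-SL₂ p q det≋1 s₀ refl refl)
                             (⟪⟫-SL₂ (q -ᵛ p) (-ᵛ p) h₁ s₁ (U-sub q p) (U-neg p)))
                     (⟪⟫-SL₂ (-ᵛ p -ᵛ (q -ᵛ p)) (-ᵛ (q -ᵛ p)) h₂ s₂ U[-p-[q-p]]≈Uq⁻¹ U[-[q-p]]≈Up-Uq))))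
      where
      s₀ = spans-SL₂ p q det≋1
      s₁ = Spans₂-swap (Spans₂-inv (Spans₂-swap (Spans₂-sub (Spans₂-swap s₀))))
      s₂ = Spans₂-inv (Spans₂-swap (Spans₂-sub s₀))
      h₁ = SL₂-tri (p , q) det≋1
      h₂ = SL₂-tri (q -ᵛ p , -ᵛ p) h₁
      -p-[q-p]≡-q : ∀ α β → ℤ.- α ℤ.+ ℤ.- (β ℤ.+ ℤ.- α) ≡ ℤ.- β
      -p-[q-p]≡-q = solve-∀
      U[-p-[q-p]]≈Uq⁻¹ : U (-ᵛ p -ᵛ (q -ᵛ p)) ≈ U q ⁻¹
      U[-p-[q-p]]≈Uq⁻¹ = trans (U-periodic { -ᵛ p -ᵛ (q -ᵛ p)} { -ᵛ q}
                                            (≋-reflexive (-p-[q-p]≡-q α β) , ≋-reflexive (-p-[q-p]≡-q γ δ)))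
                               (U-neg q)
      U[-[q-p]]≈Up-Uq : U (-ᵛ (q -ᵛ p)) ≈ U p - U q
      U[-[q-p]]≈Up-Uq = trans (U-neg (q -ᵛ p)) (trans (⁻¹-cong (U-sub q p)) (⁻¹-anti-homo‿- (U q) (U p)))

    private
      ⟪⟫-det : ∀ g g' → det g' ≡ det g → ¬ SL₂ g → ⟪ g' ⟫ ≃ zer
      ⟪⟫-det g g' det≡ det≉1 = ⟪⟫-¬SL₂ g' (det≉1 ∘ SL₂-det {g'} {g} det≡)

      ⊕-zer : ∀ {x y} → x ≃ zer → y ≃ zer → x ⊕ y ≃ zer
      ⊕-zer x≃0 y≃0 = ∼-trans (⊕-cong x≃0 y≃0) (⊕-idʳ zer)

    rot-orbit-¬SL₂ : ∀ g → ¬ SL₂ g → rot-orbit ⟪_⟫ g ≃ zer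
    rot-orbit-¬SL₂ g det≉1 =
      ⊕-zer (⊕-zer (⊕-zer (⟪⟫-¬SL₂ g det≉1) (⟪⟫-det g _ det₁ det≉1)) (⟪⟫-det g _ det₂ det≉1))
            (⟪⟫-det g _ det₃ det≉1)
      where
      det₁ = det-rot g
      det₂ = ≡.trans (det-rot (rot g)) det₁
      det₃ = ≡.trans (det-rot (rot (rot g))) det₂

    tri-orbit-¬SL₂ : ∀ g → ¬ SL₂ g → tri-orbit ⟪_⟫ g ≃ zer
    tri-orbit-¬SL₂ g det≉1 =
      ⊕-zer (⊕-zer (⟪⟫-¬SL₂ g det≉1) (⟪⟫-det g _ det₁ det≉1)) (⟪⟫-det g _ det₂ det≉1)
      where
      det₁ = det-tri g
      det₂ = ≡.trans (det-tri (tri g)) det₁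

    rot-orbit≃tri-orbit : ∀ g → rot-orbit ⟪_⟫ g ≃ tri-orbit ⟪_⟫ g
    rot-orbit≃tri-orbit g@(p , q) = [ on-SL₂ , off-SL₂ ]′ (Dec.toSum (SL₂? g))
      where
      on-SL₂ : SL₂ g → rot-orbit ⟪_⟫ g ≃ tri-orbit ⟪_⟫ g
      on-SL₂ det≋1 = ∼-trans (rot-orbit-SL₂ det≋1) (∼-sym (tri-orbit-SL₂ det≋1))
      off-SL₂ : ¬ SL₂ g → rot-orbit ⟪_⟫ g ≃ tri-orbit ⟪_⟫ g
      off-SL₂ det≉1 = ∼-trans (rot-orbit-¬SL₂ g det≉1) (∼-sym (tri-orbit-¬SL₂ g det≉1))

    ∮ᴹ-rot-orbit≃0 : ∮ᴹ (rot-orbit ⟪_⟫) ≃ zer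
    ∮ᴹ-rot-orbit≃0 = ∮ᴹ-rot-orbit≈ε ⟪_⟫ ⟪⟫-periodic rot-orbit≃tri-orbit

    S₀ : Expr A m
    S₀ = signSum A a b r s

    record Reaches (g : Mat₂) : Set (c ⊔ ℓ) where
      field reach : (det≋1 : SL₂ g) → signSumᴹ g det≋1 ≃ S₀
    open Reaches

    reaches-cong : ∀ {p p' q q'} → p ≋ᵛ p' → q ≋ᵛ q' → Reaches (p' , q') → Reaches (p , q)
    reach (reaches-cong p≋ q≋ R) det≋1 =
      ∼-trans (signSum-cong _ _ (U-periodic p≋) (U-periodic q≋)) (reach R (SL₂-cong p≋ q≋ det≋1))

    reaches-shear₁ : ∀ k g → Reaches (shear₁ k g) → Reaches g
    reach (reaches-shear₁ k g@(p , q) R) det≋1 =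
      ∼-trans (signSum-shear k _ s′)
      (∼-trans (signSum-cong s′ _ Up+kUq refl)
               (reach R (SL₂-det {g} {shear₁ k g} (≡.sym (det-shear₁ k g)) det≋1)))
      where
      s′ = Spans₂-shear k (spans-SL₂ p q det≋1)
      Up+kUq : U p ∙ k ⊙ U q ≈ U (p +ᵛ k ·ᵛ q)
      Up+kUq = sym (trans (U-+ p (k ·ᵛ q)) (∙-congˡ (U-· k q)))

    reaches-shear₂ : ∀ k g → Reaches (shear₂ k g) → Reaches g
    reach (reaches-shear₂ k g@(p , q) R) det≋1 =
      ∼-trans (signSum-swap _ s′)
      (∼-trans (signSum-shear k s′ s″)
      (∼-trans (signSum-swap s″ (Spans₂-swap s″))
      (∼-trans (signSum-cong _ _ refl Uq+kUp) (reach R (SL₂-det {g} {shear₂ k g} (≡.sym (det-shear₂ k g)) det≋1)))))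
      where
      s′ = Spans₂-swap (spans-SL₂ p q det≋1)
      s″ = Spans₂-shear k s′
      Uq+kUp : U q ∙ k ⊙ U p ≈ U (q +ᵛ k ·ᵛ p)
      Uq+kUp = sym (trans (U-+ q (k ·ᵛ p)) (∙-congˡ (U-· k p)))

    reaches-rot : ∀ g → Reaches (rot g) → Reaches g
    reach (reaches-rot g@(p , q) R) det≋1 =
      ∼-trans (signSum-rot _ s′) (∼-trans (signSum-cong s′ _ refl (sym (U-neg p))) (reach R (SL₂-rot g det≋1)))
      where
      s′ = Spans₂-rot (spans-SL₂ p q det≋1)

    reaches-id : Reaches ((ℤ.1ℤ , ℤ.0ℤ) , (ℤ.0ℤ , ℤ.1ℤ))
    reach reaches-id det≋1 = signSum-cong _ s U-e₁ U-e₂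

    -- column operations, using g δ ≡ 1, reduce the matrix to ((0 , -1) , (1 , 0)) = rot⁻¹ id
    reaches-lower : ∀ g γ δ → Reaches ((g , γ) , (ℤ.0ℤ , δ))
    reach (reaches-lower g γ δ) det≋1 = reach chain det≋1
      where
      open import Relation.Binary.Reasoning.Setoid ≋-setoid
      x-x≡0 : ∀ x → x ℤ.+ ℤ.- x ℤ.* ℤ.1ℤ ≡ ℤ.0ℤ
      x-x≡0 = solve-∀
      ring₁ : ∀ g γ → g ℤ.+ ℤ.- (γ ℤ.* g) ℤ.* ℤ.0ℤ ≡ g
      ring₁ = solve-∀
      ring₂ : ∀ δ → δ ℤ.+ δ ℤ.* ℤ.0ℤ ≡ δ
      ring₂ = solve-∀
      ring₃ : ∀ δ → ℤ.1ℤ ℤ.+ δ ℤ.* ℤ.0ℤ ≡ ℤ.1ℤ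
      ring₃ = solve-∀
      ring₄ : ∀ δ → δ ℤ.+ δ ℤ.* ℤ.-1ℤ ≡ ℤ.0ℤ
      ring₄ = solve-∀
      γ-γgδ≋0 : γ ℤ.+ ℤ.- (γ ℤ.* g) ℤ.* δ ≋ ℤ.0ℤ
      γ-γgδ≋0 = begin
        γ ℤ.+ ℤ.- (γ ℤ.* g) ℤ.* δ                      ≡⟨ ring γ g δ ⟩
        γ ℤ.+ ℤ.- γ ℤ.* det ((g , γ) , (ℤ.0ℤ , δ))     ≈⟨ +-cong-≋ (≋-refl {γ}) (*-cong-≋ (≋-refl {ℤ.- γ}) det≋1) ⟩
        γ ℤ.+ ℤ.- γ ℤ.* ℤ.1ℤ                           ≡⟨ x-x≡0 γ ⟩
        ℤ.0ℤ                                           ∎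
        where
        ring : ∀ γ g δ → γ ℤ.+ ℤ.- (γ ℤ.* g) ℤ.* δ ≡ γ ℤ.+ ℤ.- γ ℤ.* (g ℤ.* δ ℤ.- γ ℤ.* ℤ.0ℤ)
        ring = solve-∀
      δg≋1 : ℤ.0ℤ ℤ.+ δ ℤ.* g ≋ ℤ.1ℤ
      δg≋1 = ≋-trans (≋-reflexive (ring g γ δ)) det≋1
        where
        ring : ∀ g γ δ → ℤ.0ℤ ℤ.+ δ ℤ.* g ≡ g ℤ.* δ ℤ.- γ ℤ.* ℤ.0ℤ
        ring = solve-∀
      -gδ≋-1 : ℤ.0ℤ ℤ.+ ℤ.- g ℤ.* δ ≋ ℤ.-1ℤ
      -gδ≋-1 = ≋-trans (≋-reflexive (ring g γ δ)) (neg-cong-≋ det≋1)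
        where
        ring : ∀ g γ δ → ℤ.0ℤ ℤ.+ ℤ.- g ℤ.* δ ≡ ℤ.- (g ℤ.* δ ℤ.- γ ℤ.* ℤ.0ℤ)
        ring = solve-∀
      chain : Reaches ((g , γ) , (ℤ.0ℤ , δ))
      chain =
        reaches-shear₁ (ℤ.- (γ ℤ.* g)) _ $ reaches-cong (≋-reflexive (ring₁ g γ) , γ-γgδ≋0) ≋ᵛ-refl $
        reaches-shear₂ δ ((g , ℤ.0ℤ) , (ℤ.0ℤ , δ)) $ reaches-cong ≋ᵛ-refl (δg≋1 , ≋-reflexive (ring₂ δ)) $
        reaches-shear₁ (ℤ.- g) ((g , ℤ.0ℤ) , (ℤ.1ℤ , δ)) $ reaches-cong (≋-reflexive (x-x≡0 g) , -gδ≋-1) ≋ᵛ-refl $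
        reaches-shear₂ δ ((ℤ.0ℤ , ℤ.-1ℤ) , (ℤ.1ℤ , δ)) $
        reaches-cong ≋ᵛ-refl (≋-reflexive (ring₃ δ) , ≋-reflexive (ring₄ δ)) $
        reaches-rot ((ℤ.0ℤ , ℤ.-1ℤ) , (ℤ.1ℤ , ℤ.0ℤ)) reaches-id

    private
      +m-n≡m∸n : ∀ {m n} → n ℕ.≤ m → + m ℤ.+ ℤ.-1ℤ ℤ.* + n ≡ + (m ℕ.∸ n)
      +m-n≡m∸n {m} {n} n≤m =
        ≡.trans (≡.cong (λ k → + m ℤ.+ k) (ℤ.-1*i≡-i (+ n))) (≡.trans (ℤ.m-n≡m⊖n m n) (ℤ.⊖-≥ n≤m))

    -- subtractive Euclidean algorithm on the (nonnegative) first entries of p and q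
    reaches-ℕ : ∀ n α β γ δ → α ℕ.+ β ℕ.≤ n → Reaches ((+ α , γ) , (+ β , δ))
    reaches-ℕ n       α       zero    γ δ _ = reaches-lower (+ α) γ δ
    reaches-ℕ n       zero    (suc β) γ δ _ = reaches-rot _ (reaches-lower (+ suc β) δ (ℤ.- γ))
    reaches-ℕ zero    (suc α) (suc β) γ δ ()
    reaches-ℕ (suc n) (suc α) (suc β) γ δ α+β≤n with suc β ℕ.≤? suc α
    ... | yes β≤α = reaches-shear₁ ℤ.-1ℤ _ (reaches-cong (≋-reflexive (+m-n≡m∸n β≤α) , ≋-refl) ≋ᵛ-refl
                      (reaches-ℕ n (suc α ℕ.∸ suc β) (suc β) _ δ bound))
      where
      bound : suc α ℕ.∸ suc β ℕ.+ suc β ℕ.≤ n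
      bound = ℕ.≤-trans (ℕ.≤-reflexive (ℕ.m∸n+n≡m β≤α))
                        (ℕ.≤-trans (ℕ.m≤m+n (suc α) β)
                                   (ℕ.≤-trans (ℕ.≤-reflexive (≡.sym (ℕ.+-suc α β))) (ℕ.s≤s⁻¹ α+β≤n)))
    ... | no β≰α = reaches-shear₂ ℤ.-1ℤ _ (reaches-cong ≋ᵛ-refl (≋-reflexive (+m-n≡m∸n α≤β) , ≋-refl)
                      (reaches-ℕ n (suc α) (suc β ℕ.∸ suc α) γ _ bound))
      where
      α≤β = ℕ.<⇒≤ (ℕ.≰⇒> β≰α)
      bound : suc α ℕ.+ (suc β ℕ.∸ suc α) ℕ.≤ n
      bound = ℕ.≤-trans (ℕ.≤-reflexive (ℕ.m+[n∸m]≡n α≤β)) (ℕ.≤-trans (ℕ.m≤n+m (suc β) α) (ℕ.s≤s⁻¹ α+β≤n))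

    reaches : ∀ g → Reaches g
    reaches ((α , γ) , (β , δ)) =
      reaches-cong (≋-residue α , ≋-refl) (≋-residue β , ≋-refl) (reaches-ℕ _ _ _ γ δ ℕ.≤-refl)

    indicator : ∀ {P : Set} → Dec P → ℕ
    indicator (yes _) = 1
    indicator (no _)  = 0

    rot-orbit≃multiple : ∀ g (d : Dec (SL₂ g)) → rot-orbit ⟪_⟫ g ≃ indicator d ×ᴹ S₀
    rot-orbit≃multiple g (yes det≋1) =
      ∼-trans (rot-orbit-SL₂ det≋1) (∼-trans (reach (reaches g) det≋1) (∼-sym (⊕-idʳ S₀)))
    rot-orbit≃multiple g (no det≉1)  = rot-orbit-¬SL₂ g det≉1

    #SL₂ : ℕ
    #SL₂ = #.∮ᴹ (λ g → indicator (SL₂? g))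

    #SL₂×S₀≃0 : #SL₂ ×ᴹ S₀ ≃ zer
    #SL₂×S₀≃0 = ∼-trans (∼-sym (∮ᴹ-× _ S₀ (λ g → rot-orbit≃multiple g (SL₂? g)))) ∮ᴹ-rot-orbit≃0

    -- the witness -I = diag(M , M) has entries among the summation indices 0 … M
    1≤#SL₂ : 1 ℕ.≤ #SL₂
    1≤#SL₂ = ℕ.≤-trans (yes⇒1≤ (SL₂? -I) -I∈SL₂)
                       (#∮ᴹ-≥ (λ g → indicator (SL₂? g)) (Fin.fromℕ M) Fin.zero Fin.zero (Fin.fromℕ M))
      where
      -I = (+ toℕ (Fin.fromℕ M) , ℤ.0ℤ) , (ℤ.0ℤ , + toℕ (Fin.fromℕ M))
      yes⇒1≤ : ∀ {P : Set} (d : Dec P) → P → 1 ℕ.≤ indicator d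
      yes⇒1≤ (yes _) _  = ℕ.≤-refl
      yes⇒1≤ (no ¬p) p = ⊥-elim (¬p p)
      ring : ∀ x → x ℤ.* x ℤ.- ℤ.0ℤ ℤ.* ℤ.0ℤ ℤ.- ℤ.1ℤ ≡ (x ℤ.- ℤ.1ℤ) ℤ.* (ℤ.1ℤ ℤ.+ x)
      ring = solve-∀
      -I∈SL₂ : SL₂ -I
      -I∈SL₂ = ≡.subst (λ k → SL₂ ((+ k , ℤ.0ℤ) , (ℤ.0ℤ , + k))) (≡.sym (Fin.toℕ-fromℕ M))
                       (mod-∣ (divides (+ M ℤ.- ℤ.1ℤ) (ring (+ M))))

    signSum-torsion : IsZeroTensorℚ A S₀
    signSum-torsion = from-multiple #SL₂ 1≤#SL₂ #SL₂×S₀≃0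
      where
      from-multiple : ∀ n → 1 ℕ.≤ n → n ×ᴹ S₀ ≃ zer → IsZeroTensorℚ A S₀
      from-multiple (suc k) _ k+1×S₀≃0 = k , ≡.subst (_≃ zer) (≡.sym (·≡× (suc k) S₀)) k+1×S₀≃0

lemma4p2 : ∀ {c ℓ} (A : AbelianGroup c ℓ) → Finite A →
    (m : ℕ) (a₁ a₂ : AbelianGroup.Carrier A) (r : Fin m → AbelianGroup.Carrier A)
    (s : Spans A (a₁ ∷ a₂ ∷ r)) →
    IsZeroTensorℚ A (signSum A a₁ a₂ r s)
lemma4p2 A fin m a₁ a₂ r s with FiniteTorsion.finite⇒common-torsion A fin a₁ a₂
... | M , [M+1]a₁≈ε , [M+1]a₂≈ε = SignSumTorsion.signSum-torsion A m r M a₁ a₂ [M+1]a₁≈ε [M+1]a₂≈ε s
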